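{- Let $\mathcal{N}$ be the class of matroids having no minor isomorphic to $\mathsf{U}_{1,1}\oplus\mathsf{U}_{1,3}$ nor to $\mathsf{U}_{0,1}\oplus\mathsf{U}_{2,3}$. Then $\mathcal{N}$ is closed under duality, contains all sparse paving matroids, and contains the following partition matroids on $n$ elements: $\mathsf{U}_{0,n-k-\ell}\oplus(\mathsf{U}_{1,2})^{\ell}\oplus\mathsf{U}_{k-\ell,k-\ell}$ for all $0\leq k\leq n$ and $0\leq\ell\leq\min\{k,n-k\}$; $\mathsf{U}_{0,n-\ell}\oplus\mathsf{U}_{1,\ell}$ for all $3\leq\ell\leq n-1$; and $\mathsf{U}_{\ell-1,\ell}\oplus\mathsf{U}_{n-\ell,n-\ell}$ for all $3\leq\ell\leq n-1$.
   Context: $\mathsf{U}_{r,s}$ is the uniform matroid of rank $r$ on $s$ elements and $(\mathsf{U}_{1,2})^{\ell}$ the direct sum of $\ell$ copies of $\mathsf{U}_{1,2}$. A matroid is sparse paving if both it and its dual are paving (every circuit has size at least the rank). -}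

module Defs where

open import Data.Nat using (ℕ; zero; suc; _+_; _≤_; _<_)
open import Data.Fin using (Fin; _≟_)
open import Data.Fin.Subset using (Subset; _∈_; _∉_; _⊆_; _∪_; ⁅_⁆; ∣_∣; _-_; ⊤)
  renaming (⊥ to ∅)
open import Data.Fin.Subset.Properties using (_∈?_)
open import Data.Fin.Properties using (any?)
open import Data.Vec using (tabulate; take; drop)
open import Data.Product using (Σ; ∃; _×_; _,_)
open import Relation.Nullary using (¬_; Dec)
open import Relation.Nullary.Decidable using (⌊_⌋; _×-dec_)
open import Relation.Unary using (Decidable)
open import Function.Bundles using (_⇔_)
open import Function.Definitions using (Injective; Bijective)
open import Relation.Binary.PropositionalEquality using (_≡_)

-- Finite matroids on the ground set Fin n, via independent sets.
-- (Decidability of independence is classically automatic for finite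
-- matroids; it is included so the notion is well-behaved constructively.)

record Matroid (n : ℕ) : Set₁ where
  field
    Indep       : Subset n → Set
    indep?      : Decidable Indep
    indep-empty : Indep ∅
    indep-down  : ∀ {X Y} → X ⊆ Y → Indep Y → Indep X
    indep-aug   : ∀ {X Y} → Indep X → Indep Y → ∣ X ∣ < ∣ Y ∣ →
                  ∃ λ e → e ∈ Y × e ∉ X × Indep (⁅ e ⁆ ∪ X)

open Matroid public

image : ∀ {m n} → (Fin m → Fin n) → Subset m → Subset n
image f X = tabulate (λ j → ⌊ any? (λ i → (i ∈? X) ×-dec (f i ≟ j)) ⌋)

IsBasisOf : ∀ {n} → Matroid n → Subset n → Subset n → Set
IsBasisOf M C B =
  B ⊆ C × Indep M B × (∀ e → e ∈ C → e ∉ B → ¬ Indep M (⁅ e ⁆ ∪ B))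

IsBasis : ∀ {n} → Matroid n → Subset n → Set
IsBasis M B = IsBasisOf M ⊤ B

IsDual : ∀ {n} → Matroid n → Matroid n → Set
IsDual M M* = ∀ X → Indep M* X ⇔ (∃ λ B → IsBasis M B × (∀ e → e ∈ X → e ∉ B))

IsCircuit : ∀ {n} → Matroid n → Subset n → Set
IsCircuit M C = ¬ Indep M C × (∀ e → e ∈ C → Indep M (C - e))

Paving : ∀ {n} → Matroid n → Set
Paving M = ∀ C B → IsCircuit M C → IsBasis M B → ∣ B ∣ ≤ ∣ C ∣

SparsePaving : ∀ {n} → Matroid n → Set₁
SparsePaving M = Paving M × (∀ M* → IsDual M M* → Paving M*)

IndepPred : ℕ → Set₁
IndepPred m = Subset m → Set

U : (r s : ℕ) → IndepPred s
U r s X = ∣ X ∣ ≤ r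

infixr 5 _⊕_
_⊕_ : ∀ {a b} → IndepPred a → IndepPred b → IndepPred (a + b)
_⊕_ {a} P Q X = P (take a X) × Q (drop a X)

size2 : ℕ → ℕ
size2 zero = 0
size2 (suc l) = 2 + size2 l

U12pow : (l : ℕ) → IndepPred (size2 l)
U12pow zero X = Data.Unit.⊤ where import Data.Unit
U12pow (suc l) = U 1 2 ⊕ U12pow l

-- M has a minor isomorphic to the matroid with independence predicate P:
-- an injection f (the isomorphism onto E − (C ∪ D)), a contracted set C
-- disjoint from its image (D is the rest), and a basis B of C, such that
-- X is independent in the minor iff f(X) ∪ B is independent in M.
HasMinor : ∀ {n m} → Matroid n → IndepPred m → Set
HasMinor {n} {m} M P =
  Σ (Fin m → Fin n) λ f → Injective _≡_ _≡_ f ×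
  Σ (Subset n) λ C → (∀ i → f i ∉ C) ×
  Σ (Subset n) λ B → IsBasisOf M C B ×
  (∀ X → P X ⇔ Indep M (image f X ∪ B))

IsoTo : ∀ {n m} → Matroid n → IndepPred m → Set
IsoTo {n} {m} M P =
  Σ (Fin m → Fin n) λ f → Bijective _≡_ _≡_ f ×
  (∀ X → P X ⇔ Indep M (image f X))

InN : ∀ {n} → Matroid n → Set
InN M = ¬ HasMinor M (U 1 1 ⊕ U 1 3) × ¬ HasMinor M (U 0 1 ⊕ U 2 3)

-- Both excluded minors are witnessed on a handful of sets.  M has a U₁₁⊕U₁₃-minor iff there are
-- distinct e₀,…,e₃ outside an independent set I such that each e₀eᵢI is independent and each eᵢeⱼI
-- (1 ≤ i < j) is dependent; it has a U₀₁⊕U₂₃-minor iff e₀I is dependent, each eᵢeⱼI is independent and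
-- e₁e₂e₃I is dependent.  Basis exchange turns either configuration in M* into the other one in M, so 𝒩
-- is closed under duality.  In a paving matroid a circuit inside e₀I would be smaller than a basis through
-- e₁e₂I, so paving matroids avoid U₀₁⊕U₂₃; by duality sparse paving matroids avoid both minors.  The
-- partition matroids are handled through a property of the direct sum that visibly excludes both
-- configurations: rank at most one, dependence being inherited by anything containing the intersection
-- of two dependent sets, or all circuits being loops and parallel pairs with no parallel class of size three.

module Submission where

open import Defs
open import Data.Bool using (true)
open import Data.Empty using (⊥; ⊥-elim)
open import Data.Fin using (Fin; zero; suc; _≟_; _↑ˡ_; _↑ʳ_; splitAt)
open import Data.Fin.Patterns using (0F; 1F; 2F; 3F)
open import Data.Fin.Properties using (any?; all?; splitAt⁻¹-↑ˡ; splitAt⁻¹-↑ʳ)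
open import Data.Fin.Subset renaming (⊥ to ∅)
open import Data.Fin.Subset.Properties
open import Data.List using (List; []; _∷_)
open import Data.List.Relation.Unary.All using (All; []; _∷_; lookupAny)
open import Data.List.Relation.Unary.Any as Any using (Any)
open import Data.Nat using (ℕ; zero; suc; _+_; _≤_; _<_; _∸_; z≤n; s≤s; _≤?_)
open import Data.Nat.Properties hiding (_≟_)
open import Data.Product using (Σ; ∃; ∃₂; _×_; _,_; proj₁; proj₂)
open import Data.Sum using (_⊎_; inj₁; inj₂; [_,_]′)
open import Data.Vec using ([]; _∷_; here; there; take; drop)
open import Data.Vec.Properties using ([]=⇒lookup; lookup⇒[]=; lookup∘tabulate; take-zipWith; drop-zipWith)
open import Function using (_∘_; id)
open import Function.Bundles using (_⇔_; mk⇔; Equivalence)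
open import Function.Definitions using (Injective)
open import Relation.Nullary using (¬_; Dec; yes; no)
open import Relation.Nullary.Decidable
  using (True; False; ⌊_⌋; toWitness; toWitnessFalse; decidable-stable; _×-dec_; _⊎-dec_; _→-dec_; ¬?)
open import Relation.Unary using (Decidable)
open import Relation.Binary.PropositionalEquality hiding (J)

-- Finite subsets

infixr 5 _▸_
_▸_ : ∀ {n} → Fin n → Subset n → Subset n
x ▸ p = ⁅ x ⁆ ∪ p

module _ {n : ℕ} where

  Disjoint : Subset n → Subset n → Set
  Disjoint p q = ∀ x → x ∈ p → x ∉ q

  x∈x▸p : ∀ (x : Fin n) {p} → x ∈ x ▸ p
  x∈x▸p x {p} = p⊆p∪q p (x∈⁅x⁆ x)

  x∈p⇒x∈y▸p : ∀ (y : Fin n) {p x} → x ∈ p → x ∈ y ▸ p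
  x∈p⇒x∈y▸p y = q⊆p∪q ⁅ y ⁆ _

  y∈x▸y▸p : ∀ {x y : Fin n} {p} → y ∈ x ▸ y ▸ p
  y∈x▸y▸p {x} {y} = x∈p⇒x∈y▸p x (x∈x▸p y)

  p⊆x▸y▸p : ∀ {x y : Fin n} {p} → p ⊆ x ▸ y ▸ p
  p⊆x▸y▸p {x} {y} = x∈p⇒x∈y▸p x ∘ x∈p⇒x∈y▸p y

  x∈y▸p⁻ : ∀ {x y : Fin n} {p} → x ∈ y ▸ p → x ≡ y ⊎ x ∈ p
  x∈y▸p⁻ {y = y} {p} x∈ with x∈p∪q⁻ ⁅ y ⁆ p x∈
  ... | inj₁ x∈⁅y⁆ = inj₁ (x∈⁅y⁆⇒x≡y y x∈⁅y⁆)
  ... | inj₂ x∈p   = inj₂ x∈p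

  ⁅x⁆⊆p : ∀ {x : Fin n} {p} → x ∈ p → ⁅ x ⁆ ⊆ p
  ⁅x⁆⊆p {x} x∈p y∈⁅x⁆ = subst (_∈ _) (sym (x∈⁅y⁆⇒x≡y x y∈⁅x⁆)) x∈p

  x▸p⊆q : ∀ {x : Fin n} {p q} → x ∈ q → p ⊆ q → x ▸ p ⊆ q
  x▸p⊆q x∈q p⊆q y∈ with x∈y▸p⁻ y∈
  ... | inj₁ refl = x∈q
  ... | inj₂ y∈p  = p⊆q y∈p

  ▸-mono : ∀ {x : Fin n} {p q} → p ⊆ q → x ▸ p ⊆ x ▸ q
  ▸-mono {x} p⊆q = x▸p⊆q (x∈x▸p x) (x∈p⇒x∈y▸p x ∘ p⊆q)

  x▸y▸p⊆y▸x▸p : ∀ (x y : Fin n) p → x ▸ y ▸ p ⊆ y ▸ x ▸ p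
  x▸y▸p⊆y▸x▸p x y p = x▸p⊆q y∈x▸y▸p (x▸p⊆q (x∈x▸p y) p⊆x▸y▸p)

  x▸⁅y⁆⊆y▸⁅x⁆ : ∀ {x y : Fin n} → x ▸ ⁅ y ⁆ ⊆ y ▸ ⁅ x ⁆
  x▸⁅y⁆⊆y▸⁅x⁆ {x} {y} = x▸p⊆q (x∈p⇒x∈y▸p y (x∈⁅x⁆ x)) (⁅x⁆⊆p (x∈x▸p y))

  x∉y▸p : ∀ {x y : Fin n} {p} → x ≢ y → x ∉ p → x ∉ y ▸ p
  x∉y▸p x≢y x∉p x∈ with x∈y▸p⁻ x∈
  ... | inj₁ x≡y = x≢y x≡y
  ... | inj₂ x∈p = x∉p x∈p

  x∉y▸p⁻ : ∀ {x y : Fin n} {p} → x ∉ y ▸ p → x ≢ y × x ∉ p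
  x∉y▸p⁻ {x} {y} x∉ = (λ { refl → x∉ (x∈x▸p x) }) , x∉ ∘ x∈p⇒x∈y▸p y

  disjoint-▸ : ∀ {x : Fin n} {p q} → x ∉ q → Disjoint p q → Disjoint (x ▸ p) q
  disjoint-▸ x∉q p#q y y∈ with x∈y▸p⁻ y∈
  ... | inj₁ refl = x∉q
  ... | inj₂ y∈p  = p#q y y∈p

  disjoint-sym : ∀ {p q : Subset n} → Disjoint p q → Disjoint q p
  disjoint-sym p#q x x∈q x∈p = p#q x x∈p x∈q

  x∈p─q⁻ : ∀ {x : Fin n} (p q : Subset n) → x ∈ p ─ q → x ∈ p × x ∉ q
  x∈p─q⁻ = go
    where
    go : ∀ {m} {x : Fin m} (p q : Subset m) → x ∈ p ─ q → x ∈ p × x ∉ q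
    go               (inside ∷ p)  (outside ∷ q) here = here , λ ()
    go {x = zero}    (inside ∷ p)  (inside ∷ q)  ()
    go {x = zero}    (outside ∷ p) (inside ∷ q)  ()
    go {x = zero}    (outside ∷ p) (outside ∷ q) ()
    go               (_ ∷ p)       (_ ∷ q)       (there x∈) with go p q x∈
    ... | x∈p , x∉q = there x∈p , λ { (there x∈q) → x∉q x∈q }

  x∈p-y⁻ : ∀ {x y : Fin n} {p} → x ∈ p - y → x ∈ p × x ≢ y
  x∈p-y⁻ {p = p} x∈ with x∈p─q⁻ p ⁅ _ ⁆ x∈
  ... | x∈p , x∉⁅y⁆ = x∈p , x∉⁅y⁆⇒x≢y x∉⁅y⁆

  x∈p-y-z⁻ : ∀ {x y z : Fin n} {p} → x ∈ p - y - z → x ∈ p × x ≢ y × x ≢ z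
  x∈p-y-z⁻ x∈ = let x∈p-y , x≢z = x∈p-y⁻ x∈ ; x∈p , x≢y = x∈p-y⁻ x∈p-y in x∈p , x≢y , x≢z

  ∣p∣≡∣p∩q∣+∣p─q∣ : (p q : Subset n) → ∣ p ∣ ≡ ∣ p ∩ q ∣ + ∣ p ─ q ∣
  ∣p∣≡∣p∩q∣+∣p─q∣ = go
    where
    go : ∀ {m} (p q : Subset m) → ∣ p ∣ ≡ ∣ p ∩ q ∣ + ∣ p ─ q ∣
    go []            []            = refl
    go (inside ∷ p)  (inside ∷ q)  = cong suc (go p q)
    go (inside ∷ p)  (outside ∷ q) = trans (cong suc (go p q)) (sym (+-suc _ _))
    go (outside ∷ p) (inside ∷ q)  = go p q
    go (outside ∷ p) (outside ∷ q) = go p q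

  ∣p∪q∣≡∣p∣+∣q∣ : (p q : Subset n) → Disjoint p q → ∣ p ∪ q ∣ ≡ ∣ p ∣ + ∣ q ∣
  ∣p∪q∣≡∣p∣+∣q∣ p q p#q = go p q (p#q _)
    where
    go : ∀ {m} (p q : Subset m) → (∀ {x} → x ∈ p → x ∉ q) → ∣ p ∪ q ∣ ≡ ∣ p ∣ + ∣ q ∣
    go []            []            _   = refl
    go (inside ∷ p)  (inside ∷ q)  p#q = ⊥-elim (p#q here here)
    go (inside ∷ p)  (outside ∷ q) p#q = cong suc (go p q (λ x∈p x∈q → p#q (there x∈p) (there x∈q)))
    go (outside ∷ p) (inside ∷ q)  p#q =
      trans (cong suc (go p q (λ x∈p x∈q → p#q (there x∈p) (there x∈q)))) (sym (+-suc _ _))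
    go (outside ∷ p) (outside ∷ q) p#q = go p q (λ x∈p x∈q → p#q (there x∈p) (there x∈q))

  ∣x▸p∣≡1+∣p∣ : ∀ {x : Fin n} {p} → x ∉ p → ∣ x ▸ p ∣ ≡ suc ∣ p ∣
  ∣x▸p∣≡1+∣p∣ {x} {p} x∉p =
    trans (∣p∪q∣≡∣p∣+∣q∣ ⁅ x ⁆ p (λ y y∈⁅x⁆ → subst (_∉ p) (sym (x∈⁅y⁆⇒x≡y x y∈⁅x⁆)) x∉p))
          (cong (_+ ∣ p ∣) (∣⁅x⁆∣≡1 x))

  ∣x▸y▸p∣≡2+∣p∣ : ∀ {x y : Fin n} {p} → x ≢ y → x ∉ p → y ∉ p → ∣ x ▸ y ▸ p ∣ ≡ suc (suc ∣ p ∣)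
  ∣x▸y▸p∣≡2+∣p∣ x≢y x∉p y∉p = trans (∣x▸p∣≡1+∣p∣ (x∉y▸p x≢y x∉p)) (cong suc (∣x▸p∣≡1+∣p∣ y∉p))

  1+∣p-x∣≡∣p∣ : ∀ {x : Fin n} {p} → x ∈ p → suc ∣ p - x ∣ ≡ ∣ p ∣
  1+∣p-x∣≡∣p∣ {x} {p} x∈p =
    trans (sym (∣x▸p∣≡1+∣p∣ x∉p-x)) (≤-antisym (p⊆q⇒∣p∣≤∣q∣ x▸[p-x]⊆p) (p⊆q⇒∣p∣≤∣q∣ p⊆x▸[p-x]))
    where
    x∉p-x : x ∉ p - x
    x∉p-x x∈ = proj₂ (x∈p-y⁻ x∈) refl
    x▸[p-x]⊆p : x ▸ (p - x) ⊆ p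
    x▸[p-x]⊆p = x▸p⊆q x∈p (p─q⊆p p ⁅ x ⁆)
    p⊆x▸[p-x] : p ⊆ x ▸ (p - x)
    p⊆x▸[p-x] {y} y∈p with y ≟ x
    ... | yes refl = x∈x▸p x
    ... | no y≢x   = x∈p⇒x∈y▸p x (x∈p∧x≢y⇒x∈p-y y∈p y≢x)

  2+∣p-x-y∣≡∣p∣ : ∀ {x y : Fin n} {p} → x ∈ p → y ∈ p → y ≢ x → suc (suc ∣ p - x - y ∣) ≡ ∣ p ∣
  2+∣p-x-y∣≡∣p∣ x∈p y∈p y≢x = trans (cong suc (1+∣p-x∣≡∣p∣ (x∈p∧x≢y⇒x∈p-y y∈p y≢x))) (1+∣p-x∣≡∣p∣ x∈p)

∈-map-pair : ∀ {a b} (g : Fin a → Fin b) {i j k} → k ∈ i ▸ ⁅ j ⁆ → g k ∈ g i ▸ ⁅ g j ⁆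
∈-map-pair g {i} {j} k∈ with x∈y▸p⁻ k∈
... | inj₁ refl  = x∈x▸p (g i)
... | inj₂ k∈⁅j⁆ = x∈p⇒x∈y▸p (g i) (subst (λ k → g k ∈ ⁅ g j ⁆) (sym (x∈⁅y⁆⇒x≡y j k∈⁅j⁆)) (x∈⁅x⁆ (g j)))

-- Bases, circuits and duals

fuel-▸ : ∀ {n k fuel} {x : Fin n} {A} → x ∉ A → k ≤ suc fuel + ∣ A ∣ → k ≤ fuel + ∣ x ▸ A ∣
fuel-▸ {k = k} {fuel} x∉A = subst (k ≤_) (trans (sym (+-suc fuel _)) (cong (fuel +_) (sym (∣x▸p∣≡1+∣p∣ x∉A))))

module MatroidProperties {n : ℕ} (M : Matroid n) where

  indep-≤-basis : ∀ {B J} → IsBasis M B → Indep M J → ∣ J ∣ ≤ ∣ B ∣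
  indep-≤-basis {B} {J} (_ , B-indep , B-max) J-indep with ∣ J ∣ ≤? ∣ B ∣
  ... | yes J≤B = J≤B
  ... | no J≰B with indep-aug M B-indep J-indep (≰⇒> J≰B)
  ...   | e , _ , e∉B , eB-indep = ⊥-elim (B-max e ∈⊤ e∉B eB-indep)

  basis-≤ : ∀ {B B′} → IsBasis M B → IsBasis M B′ → ∣ B ∣ ≤ ∣ B′ ∣
  basis-≤ (_ , B-indep , _) B′-basis = indep-≤-basis B′-basis B-indep

  indep-of-basis-size : ∀ {B J} → IsBasis M B → Indep M J → ∣ B ∣ ≤ ∣ J ∣ → IsBasis M J
  indep-of-basis-size B-basis J-indep B≤J = ⊆⊤ , J-indep , λ e _ e∉J eJ-indep →
    <⇒≱ (subst (_ <_) (sym (∣x▸p∣≡1+∣p∣ e∉J)) (s≤s B≤J)) (indep-≤-basis B-basis eJ-indep)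

  augment : ∀ {A B} → Indep M A → Indep M B →
            Σ (Subset n) λ Z → Indep M Z × A ⊆ Z × Z ⊆ A ∪ B × ∣ B ∣ ≤ ∣ Z ∣
  augment {A} {B} = go ∣ B ∣ (m≤m+n _ _)
    where
    go : ∀ fuel {A} → ∣ B ∣ ≤ fuel + ∣ A ∣ → Indep M A → Indep M B →
         Σ (Subset n) λ Z → Indep M Z × A ⊆ Z × Z ⊆ A ∪ B × ∣ B ∣ ≤ ∣ Z ∣
    go fuel {A} B≤ A-indep B-indep with ∣ B ∣ ≤? ∣ A ∣
    ... | yes B≤A = A , A-indep , ⊆-refl , p⊆p∪q B , B≤A
    ... | no B≰A with indep-aug M A-indep B-indep (≰⇒> B≰A)
    go zero       B≤ _ _ | no B≰A | _ = ⊥-elim (B≰A B≤)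
    go (suc fuel) {A} B≤ _ B-indep | no _ | e , e∈B , e∉A , eA-indep
      with go fuel {e ▸ A} (fuel-▸ e∉A B≤) eA-indep B-indep
    ... | Z , Z-indep , eA⊆Z , Z⊆eA∪B , B≤Z =
      Z , Z-indep , (λ x∈A → eA⊆Z (x∈p⇒x∈y▸p e x∈A)) , Z⊆A∪B , B≤Z
      where
      Z⊆A∪B : Z ⊆ A ∪ B
      Z⊆A∪B x∈Z with x∈p∪q⁻ (e ▸ A) B (Z⊆eA∪B x∈Z)
      ... | inj₂ x∈B = q⊆p∪q A B x∈B
      ... | inj₁ x∈eA with x∈y▸p⁻ x∈eA
      ...   | inj₁ refl = q⊆p∪q A B e∈B
      ...   | inj₂ x∈A  = p⊆p∪q B x∈A

  extend-to-basis : ∀ {A} → Indep M A → Σ (Subset n) λ B → IsBasis M B × A ⊆ B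
  extend-to-basis = go n (m≤m+n _ _)
    where
    go : ∀ fuel {A} → n ≤ fuel + ∣ A ∣ → Indep M A → Σ (Subset n) λ B → IsBasis M B × A ⊆ B
    go fuel {A} n≤ A-indep with any? (λ e → ¬? (e ∈? A) ×-dec indep? M (e ▸ A))
    ... | no A-max = A , (⊆⊤ , A-indep , λ e _ e∉A eA-indep → A-max (e , e∉A , eA-indep)) , ⊆-refl
    go zero {A} n≤ _ | yes (e , e∉A , _) =
      ⊥-elim (<⇒≱ (subst (n <_) (sym (∣x▸p∣≡1+∣p∣ e∉A)) (s≤s n≤)) (∣p∣≤n (e ▸ A)))
    go (suc fuel) {A} n≤ _ | yes (e , e∉A , eA-indep)
      with go fuel {e ▸ A} (fuel-▸ e∉A n≤) eA-indep
    ... | B , B-basis , eA⊆B = B , B-basis , λ x∈A → eA⊆B (x∈p⇒x∈y▸p e x∈A)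

  circuit-⊆ : ∀ {S} → ¬ Indep M S → Σ (Subset n) λ C → C ⊆ S × IsCircuit M C
  circuit-⊆ {S} = go ∣ S ∣ ≤-refl
    where
    go : ∀ fuel {S} → ∣ S ∣ ≤ fuel → ¬ Indep M S → Σ (Subset n) λ C → C ⊆ S × IsCircuit M C
    go fuel {S} S≤ S-dep with any? (λ e → (e ∈? S) ×-dec ¬? (indep? M (S - e)))
    ... | no S-min = S , ⊆-refl , S-dep , S-e-indep
      where
      S-e-indep : ∀ e → e ∈ S → Indep M (S - e)
      S-e-indep e e∈S with indep? M (S - e)
      ... | yes indep = indep
      ... | no dep    = ⊥-elim (S-min (e , e∈S , dep))
    go zero       S≤ _ | yes (e , e∈S , _) = ⊥-elim (<⇒≱ (x∈p⇒∣p-x∣<∣p∣ e∈S) (≤-trans S≤ z≤n))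
    go (suc fuel) S≤ _ | yes (e , e∈S , S-e-dep)
      with go fuel (≤-pred (≤-trans (x∈p⇒∣p-x∣<∣p∣ e∈S) S≤)) S-e-dep
    ... | C , C⊆S-e , C-circuit = C , (λ x∈C → proj₁ (x∈p-y⁻ (C⊆S-e x∈C))) , C-circuit

  exchange : ∀ {B B′ J} → IsBasis M B → IsBasis M B′ → Indep M J → suc ∣ J ∣ ≡ ∣ B ∣ →
             ∃ λ e → e ∈ B′ × e ∉ J × IsBasis M (e ▸ J)
  exchange {B} {B′} {J} B-basis B′-basis@(_ , B′-indep , _) J-indep 1+J≡B
    with indep-aug M J-indep B′-indep (≤-trans (≤-reflexive 1+J≡B) (basis-≤ B-basis B′-basis))
  ... | e , e∈B′ , e∉J , eJ-indep =
    e , e∈B′ , e∉J , indep-of-basis-size B-basis eJ-indep (≤-reflexive (trans (sym 1+J≡B) (sym (∣x▸p∣≡1+∣p∣ e∉J))))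

  module BasisMinusTwo {B x y} (B-basis : IsBasis M B) (x∈B : x ∈ B) (y∈B : y ∈ B) (y≢x : y ≢ x) where

    J : Subset n
    J = B - x - y

    J⊆B : J ⊆ B
    J⊆B z∈J = proj₁ (x∈p-y-z⁻ z∈J)

    x∉J : x ∉ J
    x∉J x∈J = proj₁ (proj₂ (x∈p-y-z⁻ x∈J)) refl

    y∉J : y ∉ J
    y∉J y∈J = proj₂ (proj₂ (x∈p-y-z⁻ y∈J)) refl

    2+∣J∣≡∣B∣ : suc (suc ∣ J ∣) ≡ ∣ B ∣
    2+∣J∣≡∣B∣ = 2+∣p-x-y∣≡∣p∣ x∈B y∈B y≢x

    pair-basis : ∀ {u v} → u ≢ v → u ∉ J → v ∉ J → Indep M (u ▸ v ▸ J) → IsBasis M (u ▸ v ▸ J)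
    pair-basis u≢v u∉J v∉J uvJ-indep =
      indep-of-basis-size B-basis uvJ-indep (≤-reflexive (trans (sym 2+∣J∣≡∣B∣) (sym (∣x▸y▸p∣≡2+∣p∣ u≢v u∉J v∉J))))

    exchange-into : ∀ {u B′} → u ∉ J → Indep M (u ▸ J) → IsBasis M B′ →
                    ∃ λ e → e ∈ B′ × e ∉ u ▸ J × IsBasis M (e ▸ u ▸ J)
    exchange-into u∉J uJ-indep B′-basis =
      exchange B-basis B′-basis uJ-indep (trans (cong suc (∣x▸p∣≡1+∣p∣ u∉J)) 2+∣J∣≡∣B∣)

  isBasis? : ∀ B → Dec (IsBasis M B)
  isBasis? B = yes ⊆⊤ ×-dec indep? M B ×-dec
    all? (λ e → (e ∈? ⊤) →-dec (¬? (e ∈? B) →-dec ¬? (indep? M (e ▸ B))))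

  disjoint? : ∀ (X B : Subset n) → Dec (Disjoint X B)
  disjoint? X B = all? (λ e → (e ∈? X) →-dec ¬? (e ∈? B))

  CoIndep : Subset n → Set
  CoIndep X = ∃ λ B → IsBasis M B × Disjoint X B

  coIndep? : ∀ X → Dec (CoIndep X)
  coIndep? X = anySubset? (λ B → isBasis? B ×-dec disjoint? X B)

  coIndep-aug : ∀ {X Y} → CoIndep X → CoIndep Y → ∣ X ∣ < ∣ Y ∣ →
                ∃ λ e → e ∈ Y × e ∉ X × CoIndep (e ▸ X)
  coIndep-aug {X} {Y} (BX , BX-basis@(_ , BX-indep , _) , X#BX) (BY , BY-basis@(_ , BY-indep , _) , Y#BY) X<Y
    with any? (λ e → (e ∈? Y) ×-dec ¬? (e ∈? X) ×-dec coIndep? (e ▸ X))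
  ... | yes found = found
  ... | no none with augment (indep-down M (p─q⊆p BY X) BY-indep) BX-indep
  ...   | Z , Z-indep , BY─X⊆Z , Z⊆BY─X∪BX , BX≤Z = ⊥-elim (<-irrefl refl Z<Z)
    where
    -- Z is a basis disjoint from X, so maximality of X puts Y ─ X into Z, making Z larger than BY
    Z-basis : IsBasis M Z
    Z-basis = indep-of-basis-size BX-basis Z-indep BX≤Z
    X#Z : Disjoint X Z
    X#Z e e∈X e∈Z with x∈p∪q⁻ (BY ─ X) BX (Z⊆BY─X∪BX e∈Z)
    ... | inj₁ e∈BY─X = proj₂ (x∈p─q⁻ BY X e∈BY─X) e∈X
    ... | inj₂ e∈BX   = X#BX e e∈X e∈BX
    Y─X⊆Z : Y ─ X ⊆ Z
    Y─X⊆Z {e} e∈Y─X with e ∈? Z | x∈p─q⁻ Y X e∈Y─X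
    ... | yes e∈Z | _           = e∈Z
    ... | no e∉Z  | e∈Y , e∉X  = ⊥-elim (none (e , e∈Y , e∉X , Z , Z-basis , disjoint-▸ e∉Z X#Z))
    BY─X#Y─X : Disjoint (BY ─ X) (Y ─ X)
    BY─X#Y─X e e∈BY─X e∈Y─X = Y#BY e (proj₁ (x∈p─q⁻ Y X e∈Y─X)) (proj₁ (x∈p─q⁻ BY X e∈BY─X))
    BY─X+Y─X≤Z : ∣ BY ─ X ∣ + ∣ Y ─ X ∣ ≤ ∣ Z ∣
    BY─X+Y─X≤Z = subst (_≤ ∣ Z ∣) (∣p∪q∣≡∣p∣+∣q∣ (BY ─ X) (Y ─ X) BY─X#Y─X)
      (p⊆q⇒∣p∣≤∣q∣ λ e∈ → [ BY─X⊆Z , Y─X⊆Z ]′ (x∈p∪q⁻ (BY ─ X) (Y ─ X) e∈))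
    BY∩X≤X─Y : ∣ BY ∩ X ∣ ≤ ∣ X ─ Y ∣
    BY∩X≤X─Y = p⊆q⇒∣p∣≤∣q∣ λ {e} e∈ → let e∈BY , e∈X = x∈p∩q⁻ BY X e∈ in
      x∈p∧x∉q⇒x∈p─q e∈X (λ e∈Y → Y#BY e e∈Y e∈BY)
    X─Y<Y─X : ∣ X ─ Y ∣ < ∣ Y ─ X ∣
    X─Y<Y─X = +-cancelˡ-< ∣ X ∩ Y ∣ _ _ (subst₂ _<_ (∣p∣≡∣p∩q∣+∣p─q∣ X Y)
      (trans (∣p∣≡∣p∩q∣+∣p─q∣ Y X) (cong (λ p → ∣ p ∣ + ∣ Y ─ X ∣) (∩-comm Y X))) X<Y)
    Z<Z : ∣ Z ∣ < ∣ Z ∣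
    Z<Z = begin-strict
      ∣ Z ∣                      ≤⟨ basis-≤ Z-basis BY-basis ⟩
      ∣ BY ∣                     ≡⟨ ∣p∣≡∣p∩q∣+∣p─q∣ BY X ⟩
      ∣ BY ∩ X ∣ + ∣ BY ─ X ∣     ≤⟨ +-monoˡ-≤ _ BY∩X≤X─Y ⟩
      ∣ X ─ Y ∣ + ∣ BY ─ X ∣      <⟨ +-monoˡ-< _ X─Y<Y─X ⟩
      ∣ Y ─ X ∣ + ∣ BY ─ X ∣      ≡⟨ +-comm _ ∣ BY ─ X ∣ ⟩
      ∣ BY ─ X ∣ + ∣ Y ─ X ∣      ≤⟨ BY─X+Y─X≤Z ⟩
      ∣ Z ∣                      ∎
      where open ≤-Reasoning

  dual : Matroid n
  dual = record
    { Indep       = CoIndep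
    ; indep?      = coIndep?
    ; indep-empty = let B , B-basis , _ = extend-to-basis (indep-empty M) in B , B-basis , λ _ e∈∅ _ → ∉⊥ e∈∅
    ; indep-down  = λ X⊆Y (B , B-basis , Y#B) → B , B-basis , λ e e∈X → Y#B e (X⊆Y e∈X)
    ; indep-aug   = coIndep-aug
    }

  dual-isDual : IsDual M dual
  dual-isDual X = mk⇔ id id

module Duality {n : ℕ} (M M* : Matroid n) (M*-dual : IsDual M M*) where
  open MatroidProperties M
  open MatroidProperties M* using () renaming (indep-≤-basis to *-indep-≤-basis)

  coIndep-intro : ∀ {X B} → IsBasis M B → Disjoint X B → Indep M* X
  coIndep-intro {X} B-basis X#B = Equivalence.from (M*-dual X) (_ , B-basis , X#B)

  coIndep-elim : ∀ {X} → Indep M* X → ∃ λ B → IsBasis M B × Disjoint X B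
  coIndep-elim {X} = Equivalence.to (M*-dual X)

  ∁-basis : ∀ {B} → IsBasis M B → IsBasis M* (∁ B)
  ∁-basis {B} B-basis = ⊆⊤ , coIndep-intro B-basis (λ _ → x∈∁p⇒x∉p) , maximal
    where
    maximal : ∀ e → e ∈ ⊤ → e ∉ ∁ B → ¬ Indep M* (e ▸ ∁ B)
    maximal e _ e∉∁B e∁B-indep with coIndep-elim e∁B-indep
    ... | B′ , B′-basis , e∁B#B′ = <⇒≱ (p⊂q⇒∣p∣<∣q∣ (B′⊆B , e , x∉∁p⇒x∈p e∉∁B , e∉B′)) (basis-≤ B-basis B′-basis)
      where
      e∉B′ : e ∉ B′
      e∉B′ = e∁B#B′ e (x∈x▸p e)
      B′⊆B : B′ ⊆ B
      B′⊆B x∈B′ = x∉∁p⇒x∈p λ x∈∁B → e∁B#B′ _ (x∈p⇒x∈y▸p e x∈∁B) x∈B′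

  dual-involutive : IsDual M* M
  dual-involutive X = mk⇔ to from
    where
    to : Indep M X → ∃ λ B* → IsBasis M* B* × Disjoint X B*
    to X-indep with extend-to-basis X-indep
    ... | B , B-basis , X⊆B = ∁ B , ∁-basis B-basis , λ e e∈X → x∈p⇒x∉∁p (X⊆B e∈X)
    from : (∃ λ B* → IsBasis M* B* × Disjoint X B*) → Indep M X
    from (B* , B*-basis , X#B*) with coIndep-elim (proj₁ (proj₂ B*-basis))
    ... | B , B-basis@(_ , B-indep , _) , B*#B = indep-down M X⊆B B-indep
      where
      -- B* ⊆ ∁ B, and equality is forced because ∁ B is also independent in M*
      X⊆B : X ⊆ B
      X⊆B {e} e∈X with e ∈? B
      ... | yes e∈B = e∈B
      ... | no e∉B  = ⊥-elim (<⇒≱ (p⊂q⇒∣p∣<∣q∣ (B*⊆∁B , e , x∉p⇒x∈∁p e∉B , X#B* e e∈X))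
                                    (*-indep-≤-basis B*-basis (proj₁ (proj₂ (∁-basis B-basis)))))
        where
        B*⊆∁B : B* ⊆ ∁ B
        B*⊆∁B x∈B* = x∉p⇒x∈∁p (B*#B _ x∈B*)

-- The two excluded minors

module _ {m n} (f : Fin m → Fin n) where

  x∈image⁺ : ∀ {X i} → i ∈ X → f i ∈ image f X
  x∈image⁺ {X} {i} i∈X = lookup⇒[]= (f i) (image f X) (trans (lookup∘tabulate _ (f i)) witnessed)
    where
    witnessed : ⌊ any? (λ k → (k ∈? X) ×-dec (f k ≟ f i)) ⌋ ≡ true
    witnessed with any? (λ k → (k ∈? X) ×-dec (f k ≟ f i))
    ... | yes _ = refl
    ... | no none = ⊥-elim (none (i , i∈X , refl))

  x∈image⁻ : ∀ {X x} → x ∈ image f X → ∃ λ i → i ∈ X × f i ≡ x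
  x∈image⁻ {X} {x} x∈ = witness (trans (sym (lookup∘tabulate _ x)) ([]=⇒lookup x∈))
    where
    witness : ⌊ any? (λ k → (k ∈? X) ×-dec (f k ≟ x)) ⌋ ≡ true →
              ∃ λ i → i ∈ X × f i ≡ x
    witness _ with any? (λ k → (k ∈? X) ×-dec (f k ≟ x))
    witness _  | yes found = found
    witness () | no _

  image∪-⊆ : ∀ {X} {B T : Subset n} → (∀ i → i ∈ X → f i ∈ T) → B ⊆ T → image f X ∪ B ⊆ T
  image∪-⊆ {X} {B} fX⊆T B⊆T x∈ with x∈p∪q⁻ (image f X) B x∈
  ... | inj₂ x∈B = B⊆T x∈B
  ... | inj₁ x∈fX with x∈image⁻ x∈fX
  ...   | i , i∈X , refl = fX⊆T i i∈X

  image∪-mono : ∀ {X Y} (B : Subset n) → X ⊆ Y → image f X ∪ B ⊆ image f Y ∪ B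
  image∪-mono {Y = Y} B X⊆Y = image∪-⊆ (λ i i∈X → p⊆p∪q B (x∈image⁺ (X⊆Y i∈X))) (q⊆p∪q (image f Y) B)

all-subsets : ∀ {n} {P : Subset n → Set} (P? : Decidable P) →
              {True (¬? (anySubset? (¬? ∘ P?)))} → ∀ X → P X
all-subsets P? {no-counterexample} X =
  decidable-stable (P? X) (λ ¬PX → toWitness no-counterexample (X , ¬PX))

Covers : ∀ {m} → IndepPred m → List (Subset m) → List (Subset m) → Set
Covers P Bs Cs = ∀ X → (P X × Any (X ⊆_) Bs) ⊎ (¬ P X × Any (_⊆ X) Cs)

covers? : ∀ {m} {P : IndepPred m} → Decidable P → ∀ Bs Cs X →
          Dec ((P X × Any (X ⊆_) Bs) ⊎ (¬ P X × Any (_⊆ X) Cs))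
covers? P? Bs Cs X = (P? X ×-dec Any.any? (X ⊆?_) Bs) ⊎-dec (¬? (P? X) ×-dec Any.any? (_⊆? X) Cs)

agree-on-bases-and-circuits : ∀ {m} {P Ind : IndepPred m} {Bs Cs} →
  (∀ {X Y} → X ⊆ Y → Ind Y → Ind X) → Covers P Bs Cs →
  All Ind Bs → All (¬_ ∘ Ind) Cs → ∀ X → P X ⇔ Ind X
agree-on-bases-and-circuits Ind-down covers Bs-indep Cs-dep X with covers X
... | inj₁ (PX , X⊆B) = mk⇔ (λ _ → let B-indep , X⊆B′ = lookupAny Bs-indep X⊆B in Ind-down X⊆B′ B-indep) (λ _ → PX)
... | inj₂ (¬PX , C⊆X) = mk⇔ (λ PX → ⊥-elim (¬PX PX))
  (λ X-indep → let C-dep , C⊆X′ = lookupAny Cs-dep C⊆X in ⊥-elim (C-dep (Ind-down C⊆X′ X-indep)))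

module _ {m n} (f : Fin m → Fin n) (B : Subset n) where

  image-⁅⁆-⊆ : ∀ {i} → image f ⁅ i ⁆ ∪ B ⊆ f i ▸ B
  image-⁅⁆-⊆ {i} = image∪-⊆ f (λ k k∈⁅i⁆ → subst (λ k → f k ∈ f i ▸ B) (sym (x∈⁅y⁆⇒x≡y i k∈⁅i⁆)) (x∈x▸p (f i)))
                              (x∈p⇒x∈y▸p (f i))

  image-⁅⁆-⊇ : ∀ {i} → f i ▸ B ⊆ image f ⁅ i ⁆ ∪ B
  image-⁅⁆-⊇ {i} = x▸p⊆q (p⊆p∪q B (x∈image⁺ f (x∈⁅x⁆ i))) (q⊆p∪q _ B)

  image-▸-⊆ : ∀ {i X} → image f (i ▸ X) ∪ B ⊆ f i ▸ (image f X ∪ B)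
  image-▸-⊆ {i} {X} = image∪-⊆ f fk∈ (λ x∈B → x∈p⇒x∈y▸p (f i) (q⊆p∪q _ B x∈B))
    where
    fk∈ : ∀ k → k ∈ i ▸ X → f k ∈ f i ▸ (image f X ∪ B)
    fk∈ k k∈ with x∈y▸p⁻ k∈
    ... | inj₁ refl = x∈x▸p (f i)
    ... | inj₂ k∈X  = x∈p⇒x∈y▸p (f i) (p⊆p∪q B (x∈image⁺ f k∈X))

  image-▸-⊇ : ∀ {i X} → f i ▸ (image f X ∪ B) ⊆ image f (i ▸ X) ∪ B
  image-▸-⊇ {i} {X} = x▸p⊆q (p⊆p∪q B (x∈image⁺ f (x∈x▸p i))) (image∪-mono f B (x∈p⇒x∈y▸p i))

U? : ∀ r s → Decidable (U r s)
U? r s X = ∣ X ∣ ≤? r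

_⊕?_ : ∀ {a b} {P : IndepPred a} {Q : IndepPred b} → Decidable P → Decidable Q → Decidable (P ⊕ Q)
_⊕?_ {a} P? Q? X = P? (take a X) ×-dec Q? (drop a X)

U₁₁⊕U₁₃ U₀₁⊕U₂₃ : IndepPred 4
U₁₁⊕U₁₃ = U 1 1 ⊕ U 1 3
U₀₁⊕U₂₃ = U 0 1 ⊕ U 2 3

distinct : ∀ {m n} {f : Fin m → Fin n} → Injective _≡_ _≡_ f → ∀ i j → {False (i ≟ j)} → f i ≢ f j
distinct f-injective i j {i≢j} fi≡fj = toWitnessFalse i≢j (f-injective fi≡fj)

module _ {m n} {f : Fin m → Fin n} where

  ∉-image▸ : Injective _≡_ _≡_ f → ∀ {k} i {S} → {False (k ≟ i)} → f k ∉ S → f k ∉ f i ▸ S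
  ∉-image▸ f-injective {k} i {_} {k≢i} = x∉y▸p (distinct f-injective k i {k≢i})

  disjoint-image▸ : ∀ {T S} → (∀ i → f i ∉ T) → Disjoint T S → ∀ i → Disjoint T (f i ▸ S)
  disjoint-image▸ f∉T T#S i x x∈T = x∉y▸p (λ { refl → f∉T i x∈T }) (T#S x x∈T)

-- Minors U₁₁⊕U₁₃ and U₀₁⊕U₂₃ of M, read off on the sets that determine them: f embeds the four
-- elements (f 0F is the coloop, resp. the loop) and I is a basis of the contracted set.
record ColoopParallelTriple {n} (M : Matroid n) : Set where
  field
    f           : Fin 4 → Fin n
    f-injective : Injective _≡_ _≡_ f
    I           : Subset n
    f∉I         : ∀ i → f i ∉ I
    indep₀₁     : Indep M (f 0F ▸ f 1F ▸ I)
    indep₀₂     : Indep M (f 0F ▸ f 2F ▸ I)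
    indep₀₃     : Indep M (f 0F ▸ f 3F ▸ I)
    dep₁₂       : ¬ Indep M (f 1F ▸ f 2F ▸ I)
    dep₁₃       : ¬ Indep M (f 1F ▸ f 3F ▸ I)
    dep₂₃       : ¬ Indep M (f 2F ▸ f 3F ▸ I)

record LoopTriangle {n} (M : Matroid n) : Set where
  field
    f           : Fin 4 → Fin n
    f-injective : Injective _≡_ _≡_ f
    I           : Subset n
    f∉I         : ∀ i → f i ∉ I
    dep₀        : ¬ Indep M (f 0F ▸ I)
    indep₁₂     : Indep M (f 1F ▸ f 2F ▸ I)
    indep₁₃     : Indep M (f 1F ▸ f 3F ▸ I)
    indep₂₃     : Indep M (f 2F ▸ f 3F ▸ I)
    dep₁₂₃      : ¬ Indep M (f 1F ▸ f 2F ▸ f 3F ▸ I)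

module _ {n} (f : Fin 4 → Fin n) (B : Subset n) where

  image-pair-⊆ : ∀ {i j} → image f (i ▸ ⁅ j ⁆) ∪ B ⊆ f i ▸ f j ▸ B
  image-pair-⊆ = ⊆-trans (image-▸-⊆ f B) (▸-mono (image-⁅⁆-⊆ f B))

  image-pair-⊇ : ∀ {i j} → f i ▸ f j ▸ B ⊆ image f (i ▸ ⁅ j ⁆) ∪ B
  image-pair-⊇ = ⊆-trans (▸-mono (image-⁅⁆-⊇ f B)) (image-▸-⊇ f B)

  image-triple-⊆ : ∀ {i j k} → image f (i ▸ j ▸ ⁅ k ⁆) ∪ B ⊆ f i ▸ f j ▸ f k ▸ B
  image-triple-⊆ = ⊆-trans (image-▸-⊆ f B) (▸-mono image-pair-⊆)

  image-triple-⊇ : ∀ {i j k} → f i ▸ f j ▸ f k ▸ B ⊆ image f (i ▸ j ▸ ⁅ k ⁆) ∪ B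
  image-triple-⊇ = ⊆-trans (▸-mono image-pair-⊇) (image-▸-⊇ f B)

U₁₁⊕U₁₃-bases U₁₁⊕U₁₃-circuits U₀₁⊕U₂₃-bases U₀₁⊕U₂₃-circuits : List (Subset 4)
U₁₁⊕U₁₃-bases    = (0F ▸ ⁅ 1F ⁆) ∷ (0F ▸ ⁅ 2F ⁆) ∷ (0F ▸ ⁅ 3F ⁆) ∷ []
U₁₁⊕U₁₃-circuits = (1F ▸ ⁅ 2F ⁆) ∷ (1F ▸ ⁅ 3F ⁆) ∷ (2F ▸ ⁅ 3F ⁆) ∷ []
U₀₁⊕U₂₃-bases    = U₁₁⊕U₁₃-circuits
U₀₁⊕U₂₃-circuits = ⁅ 0F ⁆ ∷ (1F ▸ 2F ▸ ⁅ 3F ⁆) ∷ []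

U₁₁⊕U₁₃? : Decidable U₁₁⊕U₁₃
U₁₁⊕U₁₃? = U? 1 1 ⊕? U? 1 3

U₀₁⊕U₂₃? : Decidable U₀₁⊕U₂₃
U₀₁⊕U₂₃? = U? 0 1 ⊕? U? 2 3

U₁₁⊕U₁₃-covered : Covers U₁₁⊕U₁₃ U₁₁⊕U₁₃-bases U₁₁⊕U₁₃-circuits
U₁₁⊕U₁₃-covered = all-subsets (covers? U₁₁⊕U₁₃? _ _)

U₀₁⊕U₂₃-covered : Covers U₀₁⊕U₂₃ U₀₁⊕U₂₃-bases U₀₁⊕U₂₃-circuits
U₀₁⊕U₂₃-covered = all-subsets (covers? U₀₁⊕U₂₃? _ _)

module _ {n} {M : Matroid n} where

  private
    I-basisOf-I : ∀ {I} → Indep M I → IsBasisOf M I I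
    I-basisOf-I I-indep = ⊆-refl , I-indep , λ _ e∈I e∉I → ⊥-elim (e∉I e∈I)

  hasMinor⇒coloopParallelTriple : HasMinor M U₁₁⊕U₁₃ → ColoopParallelTriple M
  hasMinor⇒coloopParallelTriple (f , f-injective , C , f∉C , I , (I⊆C , _) , P⇔) = record
    { f = f ; f-injective = f-injective ; I = I ; f∉I = λ i fi∈I → f∉C i (I⊆C fi∈I)
    ; indep₀₁ = indep 0F 1F ; indep₀₂ = indep 0F 2F ; indep₀₃ = indep 0F 3F
    ; dep₁₂ = dep 1F 2F ; dep₁₃ = dep 1F 3F ; dep₂₃ = dep 2F 3F }
    where
    indep : ∀ i j → {True (U₁₁⊕U₁₃? (i ▸ ⁅ j ⁆))} → Indep M (f i ▸ f j ▸ I)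
    indep i j {PX} = indep-down M (image-pair-⊇ f I) (Equivalence.to (P⇔ _) (toWitness PX))
    dep : ∀ i j → {False (U₁₁⊕U₁₃? (i ▸ ⁅ j ⁆))} → ¬ Indep M (f i ▸ f j ▸ I)
    dep i j {¬PX} indep = toWitnessFalse ¬PX (Equivalence.from (P⇔ _) (indep-down M (image-pair-⊆ f I) indep))

  hasMinor⇒loopTriangle : HasMinor M U₀₁⊕U₂₃ → LoopTriangle M
  hasMinor⇒loopTriangle (f , f-injective , C , f∉C , I , (I⊆C , _) , P⇔) = record
    { f = f ; f-injective = f-injective ; I = I ; f∉I = λ i fi∈I → f∉C i (I⊆C fi∈I)
    ; dep₀ = λ indep → toWitnessFalse {a? = U₀₁⊕U₂₃? ⁅ 0F ⁆} _
               (Equivalence.from (P⇔ _) (indep-down M (image-⁅⁆-⊆ f I) indep))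
    ; indep₁₂ = indep 1F 2F ; indep₁₃ = indep 1F 3F ; indep₂₃ = indep 2F 3F
    ; dep₁₂₃ = λ indep → toWitnessFalse {a? = U₀₁⊕U₂₃? (1F ▸ 2F ▸ ⁅ 3F ⁆)} _
                 (Equivalence.from (P⇔ _) (indep-down M (image-triple-⊆ f I) indep)) }
    where
    indep : ∀ i j → {True (U₀₁⊕U₂₃? (i ▸ ⁅ j ⁆))} → Indep M (f i ▸ f j ▸ I)
    indep i j {PX} = indep-down M (image-pair-⊇ f I) (Equivalence.to (P⇔ _) (toWitness PX))

  coloopParallelTriple⇒hasMinor : ColoopParallelTriple M → HasMinor M U₁₁⊕U₁₃
  coloopParallelTriple⇒hasMinor p =
    f , f-injective , I , f∉I , I , I-basisOf-I (indep-down M (p⊆x▸y▸p) indep₀₁) ,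
    agree-on-bases-and-circuits (λ X⊆Y → indep-down M (image∪-mono f I X⊆Y)) U₁₁⊕U₁₃-covered
      (indep indep₀₁ ∷ indep indep₀₂ ∷ indep indep₀₃ ∷ [])
      (dep dep₁₂ ∷ dep dep₁₃ ∷ dep dep₂₃ ∷ [])
    where
    open ColoopParallelTriple p
    indep : ∀ {i j} → Indep M (f i ▸ f j ▸ I) → Indep M (image f (i ▸ ⁅ j ⁆) ∪ I)
    indep = indep-down M (image-pair-⊆ f I)
    dep : ∀ {i j} → ¬ Indep M (f i ▸ f j ▸ I) → ¬ Indep M (image f (i ▸ ⁅ j ⁆) ∪ I)
    dep d = d ∘ indep-down M (image-pair-⊇ f I)

  loopTriangle⇒hasMinor : LoopTriangle M → HasMinor M U₀₁⊕U₂₃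
  loopTriangle⇒hasMinor p =
    f , f-injective , I , f∉I , I , I-basisOf-I (indep-down M (p⊆x▸y▸p) indep₁₂) ,
    agree-on-bases-and-circuits (λ X⊆Y → indep-down M (image∪-mono f I X⊆Y)) U₀₁⊕U₂₃-covered
      (indep indep₁₂ ∷ indep indep₁₃ ∷ indep indep₂₃ ∷ [])
      ((dep₀ ∘ indep-down M (image-⁅⁆-⊇ f I)) ∷ (dep₁₂₃ ∘ indep-down M (image-triple-⊇ f I)) ∷ [])
    where
    open LoopTriangle p
    indep : ∀ {i j} → Indep M (f i ▸ f j ▸ I) → Indep M (image f (i ▸ ⁅ j ⁆) ∪ I)
    indep = indep-down M (image-pair-⊆ f I)

-- Duality exchanges the two minors

module DualMinors {n : ℕ} (M M* : Matroid n) (M*-dual : IsDual M M*) where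
  open MatroidProperties M
  open Duality M M* M*-dual

  forced-into-basis : ∀ {S X B x} → ¬ Indep M* S → S ⊆ x ▸ X → IsBasis M B → Disjoint X B → x ∈ B
  forced-into-basis {B = B} {x} S-dep S⊆xX B-basis X#B with x ∈? B
  ... | yes x∈B = x∈B
  ... | no x∉B  = ⊥-elim (S-dep (indep-down M* S⊆xX (coIndep-intro B-basis (disjoint-▸ x∉B X#B))))

  -- A basis B₁₂ of M avoiding f₁f₂I* must contain f₀ and f₃; J = B₁₂ - f₀ - f₃ replaces I*.  Exchanging f₀J
  -- towards another basis either adds the wanted fₖ or yields a basis avoiding a dependent set of M*.
  loopTriangle*⇒coloopParallelTriple : LoopTriangle M* → ColoopParallelTriple M
  loopTriangle*⇒coloopParallelTriple t
    with coIndep-elim (LoopTriangle.indep₁₂ t) | coIndep-elim (LoopTriangle.indep₁₃ t)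
       | coIndep-elim (LoopTriangle.indep₂₃ t)
  ... | B₁₂ , B₁₂-basis@(_ , B₁₂-indep , _) , f₁f₂I*#B₁₂ | B₁₃ , B₁₃-basis , f₁f₃I*#B₁₃
      | B₂₃ , B₂₃-basis , f₂f₃I*#B₂₃ = record
    { f = f ; f-injective = f-injective ; I = J ; f∉I = f∉J
    ; indep₀₁ = indep₀ 1F B₂₃-basis λ x x∈B₂₃ x≢f₁ → x∉y▸p x≢f₁ (λ x∈ → f₂f₃I*#B₂₃ x x∈ x∈B₂₃)
    ; indep₀₂ = indep₀ 2F B₁₃-basis λ x x∈B₁₃ x≢f₂ →
        let x≢f₁ , x∉f₃I* = x∉y▸p⁻ (λ x∈ → f₁f₃I*#B₁₃ x x∈ x∈B₁₃) in x∉y▸p x≢f₁ (x∉y▸p x≢f₂ x∉f₃I*)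
    ; indep₀₃ = indep-down M (x▸p⊆q f₀∈B₁₂ (x▸p⊆q f₃∈B₁₂ J⊆B)) B₁₂-indep
    ; dep₁₂ = dep 1F 2F ; dep₁₃ = dep 1F 3F ; dep₂₃ = dep 2F 3F
    }
    where
    open LoopTriangle t renaming (I to I*; f∉I to f∉I*)
    f₀∈B₁₂ : f 0F ∈ B₁₂
    f₀∈B₁₂ = forced-into-basis dep₀ ⊆-refl B₁₂-basis (λ x → f₁f₂I*#B₁₂ x ∘ p⊆x▸y▸p)
    f₃∈B₁₂ : f 3F ∈ B₁₂
    f₃∈B₁₂ = forced-into-basis dep₁₂₃
      (⊆-trans (▸-mono (x▸y▸p⊆y▸x▸p (f 2F) (f 3F) I*)) (x▸y▸p⊆y▸x▸p (f 1F) (f 3F) (f 2F ▸ I*)))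
      B₁₂-basis f₁f₂I*#B₁₂
    open BasisMinusTwo B₁₂-basis f₀∈B₁₂ f₃∈B₁₂ (distinct f-injective 3F 0F)
    I*#J : Disjoint I* J
    I*#J x x∈I* = f₁f₂I*#B₁₂ x (p⊆x▸y▸p x∈I*) ∘ J⊆B
    f∉J : ∀ i → f i ∉ J
    f∉J 0F = x∉J
    f∉J 1F = f₁f₂I*#B₁₂ _ (x∈x▸p _) ∘ J⊆B
    f∉J 2F = f₁f₂I*#B₁₂ _ y∈x▸y▸p ∘ J⊆B
    f∉J 3F = y∉J
    dep : ∀ j k → {False (j ≟ k)} → {False (0F ≟ j)} → {False (0F ≟ k)} → ¬ Indep M (f j ▸ f k ▸ J)
    dep j k {j≢k} {0≢j} {0≢k} fⱼfₖJ-indep = dep₀ (coIndep-intro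
      (pair-basis (distinct f-injective j k {j≢k}) (f∉J j) (f∉J k) fⱼfₖJ-indep)
      (disjoint-▸ (∉-image▸ f-injective j {_} {0≢j} (∉-image▸ f-injective k {_} {0≢k} x∉J))
                  (disjoint-image▸ f∉I* (disjoint-image▸ f∉I* I*#J k) j)))
    indep₀ : ∀ k {B} → IsBasis M B → (∀ x → x ∈ B → x ≢ f k → x ∉ f 1F ▸ f 2F ▸ f 3F ▸ I*) →
             Indep M (f 0F ▸ f k ▸ J)
    indep₀ k B-basis B-avoids with exchange-into x∉J (indep-down M (x▸p⊆q f₀∈B₁₂ J⊆B) B₁₂-indep) B-basis
    ... | e , e∈B , _ , ef₀J-basis with e ≟ f k
    ...   | yes refl = indep-down M (x▸y▸p⊆y▸x▸p (f 0F) e J) (proj₁ (proj₂ ef₀J-basis))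
    ...   | no e≢fₖ  = ⊥-elim (dep₁₂₃ (coIndep-intro ef₀J-basis (disjoint-sym
      (disjoint-▸ (B-avoids e e∈B e≢fₖ)
        (disjoint-▸ (∉-image▸ f-injective 1F (∉-image▸ f-injective 2F (∉-image▸ f-injective 3F (f∉I* 0F))))
          (disjoint-image▸ f∉J (disjoint-image▸ f∉J (disjoint-image▸ f∉J (disjoint-sym I*#J) 3F) 2F) 1F))))))

  -- Dually, a basis A₁ of M avoiding f₀f₁I* must contain f₂ and f₃, and J = A₁ - f₂ - f₃ replaces I*.
  coloopParallelTriple*⇒loopTriangle : ColoopParallelTriple M* → LoopTriangle M
  coloopParallelTriple*⇒loopTriangle t
    with coIndep-elim (ColoopParallelTriple.indep₀₁ t) | coIndep-elim (ColoopParallelTriple.indep₀₂ t)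
       | coIndep-elim (ColoopParallelTriple.indep₀₃ t)
  ... | A₁ , A₁-basis@(_ , A₁-indep , _) , f₀f₁I*#A₁ | A₂ , A₂-basis , f₀f₂I*#A₂ | A₃ , A₃-basis , f₀f₃I*#A₃ = record
    { f = f ; f-injective = f-injective ; I = J ; f∉I = f∉J
    ; dep₀ = dep₀
    ; indep₁₂ = indep₁ 2F 3F f₂∈A₁ A₃-basis (λ x x∈A₃ → proj₂ (x∉y▸p⁻ (λ x∈ → f₀f₃I*#A₃ x x∈ x∈A₃))) dep₁₃
    ; indep₁₃ = indep₁ 3F 2F f₃∈A₁ A₂-basis (λ x x∈A₂ → proj₂ (x∉y▸p⁻ (λ x∈ → f₀f₂I*#A₂ x x∈ x∈A₂))) dep₁₂
    ; indep₂₃ = indep-down M (x▸p⊆q f₂∈A₁ (x▸p⊆q f₃∈A₁ J⊆B)) A₁-indep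
    ; dep₁₂₃ = λ f₁f₂f₃J-indep → <-irrefl refl (begin-strict
        ∣ A₁ ∣                       ≡⟨ sym 2+∣J∣≡∣B∣ ⟩
        suc (suc ∣ J ∣)               ≡⟨ sym (∣x▸y▸p∣≡2+∣p∣ (distinct f-injective 2F 3F) x∉J y∉J) ⟩
        ∣ f 2F ▸ f 3F ▸ J ∣           <⟨ ≤-reflexive (sym (∣x▸p∣≡1+∣p∣ (∉-image▸ f-injective 2F
                                                           (∉-image▸ f-injective 3F (f∉J 1F))))) ⟩
        ∣ f 1F ▸ f 2F ▸ f 3F ▸ J ∣    ≤⟨ indep-≤-basis A₁-basis f₁f₂f₃J-indep ⟩
        ∣ A₁ ∣                       ∎)
    }
    where
    open ColoopParallelTriple t renaming (I to I*; f∉I to f∉I*)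
    open ≤-Reasoning
    f₁I*#A₁ : Disjoint (f 1F ▸ I*) A₁
    f₁I*#A₁ x = f₀f₁I*#A₁ x ∘ x∈p⇒x∈y▸p _
    f₂∈A₁ : f 2F ∈ A₁
    f₂∈A₁ = forced-into-basis dep₁₂ (x▸y▸p⊆y▸x▸p (f 1F) (f 2F) I*) A₁-basis f₁I*#A₁
    f₃∈A₁ : f 3F ∈ A₁
    f₃∈A₁ = forced-into-basis dep₁₃ (x▸y▸p⊆y▸x▸p (f 1F) (f 3F) I*) A₁-basis f₁I*#A₁
    open BasisMinusTwo A₁-basis f₂∈A₁ f₃∈A₁ (distinct f-injective 3F 2F)
    J#I* : Disjoint J I*
    J#I* x x∈J x∈I* = f₀f₁I*#A₁ x (p⊆x▸y▸p x∈I*) (J⊆B x∈J)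
    f∉J : ∀ i → f i ∉ J
    f∉J 0F = f₀f₁I*#A₁ _ (x∈x▸p _) ∘ J⊆B
    f∉J 1F = f₀f₁I*#A₁ _ y∈x▸y▸p ∘ J⊆B
    f∉J 2F = x∉J
    f∉J 3F = y∉J
    J#fᵢfⱼI* : ∀ i j → Disjoint J (f i ▸ f j ▸ I*)
    J#fᵢfⱼI* i j = disjoint-image▸ f∉J (disjoint-image▸ f∉J J#I* j) i
    indep₁ : ∀ k l → {False (k ≟ 1F)} → {False (k ≟ l)} →
             f k ∈ A₁ → ∀ {A} → IsBasis M A → (∀ x → x ∈ A → x ∉ f l ▸ I*) →
             ¬ Indep M* (f 1F ▸ f l ▸ I*) → Indep M (f 1F ▸ f k ▸ J)
    indep₁ k l {k≢1} {k≢l} fₖ∈A₁ A-basis A-avoids dep₁ₗ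
      with exchange-into (f∉J k) (indep-down M (x▸p⊆q fₖ∈A₁ J⊆B) A₁-indep) A-basis
    ... | e , e∈A , _ , efₖJ-basis with e ≟ f 1F
    ...   | yes refl = proj₁ (proj₂ efₖJ-basis)
    ...   | no e≢f₁  = ⊥-elim (dep₁ₗ (coIndep-intro efₖJ-basis (disjoint-sym
      (disjoint-▸ (x∉y▸p e≢f₁ (A-avoids e e∈A))
        (disjoint-▸ (∉-image▸ f-injective 1F {_} {k≢1} (∉-image▸ f-injective l {_} {k≢l} (f∉I* k)))
          (J#fᵢfⱼI* 1F l))))))
    dep₀ : ¬ Indep M (f 0F ▸ J)
    dep₀ f₀J-indep with exchange-into (f∉J 0F) f₀J-indep A₂-basis
    ... | e , e∈A₂ , _ , ef₀J-basis with e ≟ f 3F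
    ...   | yes refl = dep₁₂ (coIndep-intro ef₀J-basis (disjoint-sym
      (disjoint-▸ (∉-image▸ f-injective 1F (∉-image▸ f-injective 2F (f∉I* 3F)))
        (disjoint-▸ (∉-image▸ f-injective 1F (∉-image▸ f-injective 2F (f∉I* 0F))) (J#fᵢfⱼI* 1F 2F)))))
    ...   | no e≢f₃  = dep₂₃ (coIndep-intro ef₀J-basis (disjoint-sym
      (disjoint-▸ e∉f₂f₃I*
        (disjoint-▸ (∉-image▸ f-injective 2F (∉-image▸ f-injective 3F (f∉I* 0F))) (J#fᵢfⱼI* 2F 3F)))))
      where
      e∉f₂f₃I* : e ∉ f 2F ▸ f 3F ▸ I*
      e∉f₂f₃I* = let _ , e∉f₂I* = x∉y▸p⁻ (λ e∈ → f₀f₂I*#A₂ e e∈ e∈A₂) ; e≢f₂ , e∉I* = x∉y▸p⁻ e∉f₂I* in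
                 x∉y▸p e≢f₂ (x∉y▸p e≢f₃ e∉I*)

-- Properties that exclude the minors

module _ {n} (M : Matroid n) where
  open MatroidProperties M

  paving⇒¬loopTriangle : Paving M → ¬ LoopTriangle M
  paving⇒¬loopTriangle M-paving t with circuit-⊆ (LoopTriangle.dep₀ t) | extend-to-basis (LoopTriangle.indep₁₂ t)
  ... | C , C⊆f₀I , C-circuit | B , B-basis , f₁f₂I⊆B = <-irrefl refl (begin-strict
    suc ∣ I ∣             <⟨ ≤-reflexive (sym (∣x▸y▸p∣≡2+∣p∣ (distinct f-injective 1F 2F) (f∉I 1F) (f∉I 2F))) ⟩
    ∣ f 1F ▸ f 2F ▸ I ∣   ≤⟨ p⊆q⇒∣p∣≤∣q∣ f₁f₂I⊆B ⟩
    ∣ B ∣                 ≤⟨ M-paving C B C-circuit B-basis ⟩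
    ∣ C ∣                 ≤⟨ p⊆q⇒∣p∣≤∣q∣ C⊆f₀I ⟩
    ∣ f 0F ▸ I ∣          ≡⟨ ∣x▸p∣≡1+∣p∣ (f∉I 0F) ⟩
    suc ∣ I ∣             ∎)
    where
    open LoopTriangle t
    open ≤-Reasoning

DownClosed : ∀ {m} → IndepPred m → Set
DownClosed P = ∀ {X Y} → X ⊆ Y → P Y → P X

RankAtMostOne : ∀ {m} → IndepPred m → Set
RankAtMostOne P = ∀ X {x y} → x ≢ y → x ∈ X → y ∈ X → ¬ P X

DependentMeets : ∀ {m} → IndepPred m → Set
DependentMeets P = ∀ {X Y Z} → ¬ P X → ¬ P Y → X ∩ Y ⊆ Z → ¬ P Z

PairDetermined : ∀ {m} → IndepPred m → Set
PairDetermined P = ∀ X → ¬ P X → ∃₂ λ x y → x ∈ X × y ∈ X × ¬ P (x ▸ ⁅ y ⁆)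

NoParallelTriple : ∀ {m} → IndepPred m → Set
NoParallelTriple P = ∀ x y z → P ⁅ x ⁆ → P ⁅ y ⁆ → P ⁅ z ⁆ → ¬ P (x ▸ ⁅ y ⁆) → ¬ P (x ▸ ⁅ z ⁆) →
                     x ≡ y ⊎ x ≡ z ⊎ y ≡ z

no-three-in-two : ∀ {n} {a b c x y : Fin n} → a ≢ b → a ≢ c → b ≢ c →
                  x ≡ a ⊎ y ≡ a → x ≡ b ⊎ y ≡ b → x ≡ c ⊎ y ≡ c → ⊥
no-three-in-two a≢b a≢c b≢c (inj₁ refl) (inj₁ refl) _           = a≢b refl
no-three-in-two a≢b a≢c b≢c (inj₂ refl) (inj₂ refl) _           = a≢b refl
no-three-in-two a≢b a≢c b≢c (inj₁ refl) (inj₂ refl) (inj₁ refl) = a≢c refl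
no-three-in-two a≢b a≢c b≢c (inj₁ refl) (inj₂ refl) (inj₂ refl) = b≢c refl
no-three-in-two a≢b a≢c b≢c (inj₂ refl) (inj₁ refl) (inj₁ refl) = b≢c refl
no-three-in-two a≢b a≢c b≢c (inj₂ refl) (inj₁ refl) (inj₂ refl) = a≢c refl

module _ {m} {P : IndepPred m} (P-down : DownClosed P) where

  dependent-pair-hits : ∀ {S T w x y} → P T → S ⊆ w ▸ T → x ∈ S → y ∈ S → ¬ P (x ▸ ⁅ y ⁆) → x ≡ w ⊎ y ≡ w
  dependent-pair-hits {S} {T} {w} {x} {y} T-indep S⊆wT x∈S y∈S xy-dep with x ≟ w | y ≟ w
  ... | yes x≡w | _       = inj₁ x≡w
  ... | no _    | yes y≡w = inj₂ y≡w
  ... | no x≢w  | no y≢w  = ⊥-elim (xy-dep (P-down (x▸p⊆q (∈T x∈S x≢w) (⁅x⁆⊆p (∈T y∈S y≢w))) T-indep))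
    where
    ∈T : ∀ {z} → z ∈ S → z ≢ w → z ∈ T
    ∈T z∈S z≢w with x∈y▸p⁻ (S⊆wT z∈S)
    ... | inj₁ z≡w = ⊥-elim (z≢w z≡w)
    ... | inj₂ z∈T = z∈T

  dependent-pair : PairDetermined P → ∀ {u v I} → u ≢ v → P (u ▸ I) → P (v ▸ I) → ¬ P (u ▸ v ▸ I) → ¬ P (u ▸ ⁅ v ⁆)
  dependent-pair P-pairs {u} {v} {I} u≢v uI-indep vI-indep uvI-dep
    with P-pairs _ uvI-dep
  ... | x , y , x∈ , y∈ , xy-dep
    with dependent-pair-hits vI-indep ⊆-refl x∈ y∈ xy-dep
       | dependent-pair-hits uI-indep (x▸y▸p⊆y▸x▸p u v I) x∈ y∈ xy-dep
  ... | inj₁ refl | inj₁ refl = λ _ → u≢v refl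
  ... | inj₁ refl | inj₂ refl = xy-dep
  ... | inj₂ refl | inj₁ refl = xy-dep ∘ P-down x▸⁅y⁆⊆y▸⁅x⁆
  ... | inj₂ refl | inj₂ refl = λ _ → u≢v refl

module _ {n} (M : Matroid n) where

  rank≤1⇒InN : RankAtMostOne (Indep M) → InN M
  rank≤1⇒InN rank≤1 =
    ¬coloopParallelTriple ∘ hasMinor⇒coloopParallelTriple , ¬loopTriangle ∘ hasMinor⇒loopTriangle
    where
    ¬coloopParallelTriple : ¬ ColoopParallelTriple M
    ¬coloopParallelTriple p = rank≤1 _ (distinct f-injective 0F 1F) (x∈x▸p _) y∈x▸y▸p indep₀₁
      where open ColoopParallelTriple p
    ¬loopTriangle : ¬ LoopTriangle M
    ¬loopTriangle t = rank≤1 _ (distinct f-injective 1F 2F) (x∈x▸p _) y∈x▸y▸p indep₁₂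
      where open LoopTriangle t

  dependentMeets⇒InN : DependentMeets (Indep M) → InN M
  dependentMeets⇒InN meets =
    ¬coloopParallelTriple ∘ hasMinor⇒coloopParallelTriple , ¬loopTriangle ∘ hasMinor⇒loopTriangle
    where
    ¬coloopParallelTriple : ¬ ColoopParallelTriple M
    ¬coloopParallelTriple p = meets dep₁₂ dep₁₃ meet⊆ indep₀₁
      where
      open ColoopParallelTriple p
      meet⊆ : (f 1F ▸ f 2F ▸ I) ∩ (f 1F ▸ f 3F ▸ I) ⊆ f 0F ▸ f 1F ▸ I
      meet⊆ x∈ with x∈p∩q⁻ _ _ x∈
      ... | x∈f₁f₂I , x∈f₁f₃I with x∈y▸p⁻ x∈f₁f₂I
      ... | inj₁ refl = y∈x▸y▸p
      ... | inj₂ x∈f₂I with x∈y▸p⁻ x∈f₂I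
      ...   | inj₂ x∈I  = p⊆x▸y▸p x∈I
      ...   | inj₁ refl = ⊥-elim (∉-image▸ f-injective 1F (∉-image▸ f-injective 3F (f∉I 2F)) x∈f₁f₃I)
    ¬loopTriangle : ¬ LoopTriangle M
    ¬loopTriangle t = meets dep₀ dep₁₂₃ meet⊆ (indep-down M p⊆x▸y▸p indep₁₂)
      where
      open LoopTriangle t
      meet⊆ : (f 0F ▸ I) ∩ (f 1F ▸ f 2F ▸ f 3F ▸ I) ⊆ I
      meet⊆ x∈ with x∈p∩q⁻ _ _ x∈
      ... | x∈f₀I , x∈f₁f₂f₃I with x∈y▸p⁻ x∈f₀I
      ... | inj₂ x∈I  = x∈I
      ... | inj₁ refl = ⊥-elim (x∉y▸p (distinct f-injective 0F 1F) (x∉y▸p (distinct f-injective 0F 2F)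
                          (x∉y▸p (distinct f-injective 0F 3F) (f∉I 0F))) x∈f₁f₂f₃I)

  loopsAndParallelPairs⇒InN : PairDetermined (Indep M) → NoParallelTriple (Indep M) → InN M
  loopsAndParallelPairs⇒InN pairs no-triple =
    ¬coloopParallelTriple ∘ hasMinor⇒coloopParallelTriple , ¬loopTriangle ∘ hasMinor⇒loopTriangle
    where
    ¬coloopParallelTriple : ¬ ColoopParallelTriple M
    ¬coloopParallelTriple p
      with no-triple (f 1F) (f 2F) (f 3F) (non-loop indep₀₁) (non-loop indep₀₂) (non-loop indep₀₃)
      (dependent-pair (indep-down M) pairs (distinct f-injective 1F 2F) (drop₀ indep₀₁) (drop₀ indep₀₂) dep₁₂)
      (dependent-pair (indep-down M) pairs (distinct f-injective 1F 3F) (drop₀ indep₀₁) (drop₀ indep₀₃) dep₁₃)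
      where
      open ColoopParallelTriple p
      non-loop : ∀ {k} → Indep M (f 0F ▸ f k ▸ I) → Indep M ⁅ f k ⁆
      non-loop = indep-down M (⁅x⁆⊆p y∈x▸y▸p)
      drop₀ : ∀ {k} → Indep M (f 0F ▸ f k ▸ I) → Indep M (f k ▸ I)
      drop₀ = indep-down M (x∈p⇒x∈y▸p _)
    ... | inj₁ f₁≡f₂        = distinct (ColoopParallelTriple.f-injective p) 1F 2F f₁≡f₂
    ... | inj₂ (inj₁ f₁≡f₃) = distinct (ColoopParallelTriple.f-injective p) 1F 3F f₁≡f₃
    ... | inj₂ (inj₂ f₂≡f₃) = distinct (ColoopParallelTriple.f-injective p) 2F 3F f₂≡f₃
    ¬loopTriangle : ¬ LoopTriangle M
    ¬loopTriangle t with pairs _ dep₁₂₃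
      where open LoopTriangle t
    ... | x , y , x∈ , y∈ , xy-dep = no-three-in-two
      (distinct f-injective 1F 2F) (distinct f-injective 1F 3F) (distinct f-injective 2F 3F)
      (dependent-pair-hits (indep-down M) indep₂₃ ⊆-refl x∈ y∈ xy-dep)
      (dependent-pair-hits (indep-down M) indep₁₃ (x▸y▸p⊆y▸x▸p (f 1F) (f 2F) _) x∈ y∈ xy-dep)
      (dependent-pair-hits (indep-down M) indep₁₂
        (⊆-trans (▸-mono (x▸y▸p⊆y▸x▸p (f 2F) (f 3F) I)) (x▸y▸p⊆y▸x▸p (f 1F) (f 3F) (f 2F ▸ I))) x∈ y∈ xy-dep)
      where open LoopTriangle t

module Relabel {n m} (M : Matroid n) {P : IndepPred m} (iso : IsoTo M P) where

  private
    f = proj₁ iso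
    f-injective = proj₁ (proj₁ (proj₂ iso))
    f-surjective = proj₂ (proj₁ (proj₂ iso))
    P⇔ = proj₂ (proj₂ iso)

  f⁻¹ : Fin n → Fin m
  f⁻¹ y = proj₁ (f-surjective y)

  f∘f⁻¹ : ∀ y → f (f⁻¹ y) ≡ y
  f∘f⁻¹ y = proj₂ (f-surjective y) refl

  f⁻¹∘f : ∀ i → f⁻¹ (f i) ≡ i
  f⁻¹∘f i = f-injective (f∘f⁻¹ (f i))

  f⁻¹-injective : ∀ {x y} → f⁻¹ x ≡ f⁻¹ y → x ≡ y
  f⁻¹-injective {x} {y} e = trans (sym (f∘f⁻¹ x)) (trans (cong f e) (f∘f⁻¹ y))

  preimage : Subset n → Subset m
  preimage = image f⁻¹

  ∈-preimage⁺ : ∀ {Y i} → f i ∈ Y → i ∈ preimage Y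
  ∈-preimage⁺ {i = i} fi∈Y = subst (_∈ _) (f⁻¹∘f i) (x∈image⁺ f⁻¹ fi∈Y)

  ∈-preimage⁻ : ∀ {Y i} → i ∈ preimage Y → f i ∈ Y
  ∈-preimage⁻ i∈ with x∈image⁻ f⁻¹ i∈
  ... | y , y∈Y , refl = subst (_∈ _) (sym (f∘f⁻¹ y)) y∈Y

  indep⇒P : ∀ {Y} → Indep M Y → P (preimage Y)
  indep⇒P {Y} Y-indep = Equivalence.from (P⇔ (preimage Y)) (indep-down M image-preimage⊆ Y-indep)
    where
    image-preimage⊆ : image f (preimage Y) ⊆ Y
    image-preimage⊆ y∈ with x∈image⁻ f y∈
    ... | i , i∈ , refl = ∈-preimage⁻ i∈

  P⇒indep : ∀ {Y} → P (preimage Y) → Indep M Y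
  P⇒indep {Y} PY = indep-down M ⊆image-preimage (Equivalence.to (P⇔ (preimage Y)) PY)
    where
    ⊆image-preimage : Y ⊆ image f (preimage Y)
    ⊆image-preimage {y} y∈Y =
      subst (_∈ _) (f∘f⁻¹ y) (x∈image⁺ f (∈-preimage⁺ (subst (_∈ Y) (sym (f∘f⁻¹ y)) y∈Y)))

  pair-⊆-preimage : ∀ {i j} → i ▸ ⁅ j ⁆ ⊆ preimage (f i ▸ ⁅ f j ⁆)
  pair-⊆-preimage k∈ = ∈-preimage⁺ (∈-map-pair f k∈)

  preimage-pair-⊆ : ∀ {x y} → preimage (x ▸ ⁅ y ⁆) ⊆ f⁻¹ x ▸ ⁅ f⁻¹ y ⁆
  preimage-pair-⊆ i∈ with x∈image⁻ f⁻¹ i∈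
  ... | k , k∈ , refl = ∈-map-pair f⁻¹ k∈

  rankAtMostOne : RankAtMostOne P → RankAtMostOne (Indep M)
  rankAtMostOne P-rank≤1 Y u≢v u∈Y v∈Y =
    P-rank≤1 (preimage Y) (u≢v ∘ f⁻¹-injective) (x∈image⁺ f⁻¹ u∈Y) (x∈image⁺ f⁻¹ v∈Y) ∘ indep⇒P

  dependentMeets : DependentMeets P → DependentMeets (Indep M)
  dependentMeets P-meets {X} {Y} {Z} X-dep Y-dep X∩Y⊆Z =
    P-meets (X-dep ∘ P⇒indep) (Y-dep ∘ P⇒indep) preimage-∩ ∘ indep⇒P
    where
    preimage-∩ : preimage X ∩ preimage Y ⊆ preimage Z
    preimage-∩ i∈ = let i∈X , i∈Y = x∈p∩q⁻ _ _ i∈ in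
      ∈-preimage⁺ (X∩Y⊆Z (x∈p∩q⁺ (∈-preimage⁻ i∈X , ∈-preimage⁻ i∈Y)))

  pairDetermined : DownClosed P → PairDetermined P → PairDetermined (Indep M)
  pairDetermined P-down P-pairs Y Y-dep with P-pairs (preimage Y) (Y-dep ∘ P⇒indep)
  ... | i , j , i∈ , j∈ , ij-dep =
    f i , f j , ∈-preimage⁻ i∈ , ∈-preimage⁻ j∈ , ij-dep ∘ P-down pair-⊆-preimage ∘ indep⇒P

  noParallelTriple : DownClosed P → NoParallelTriple P → NoParallelTriple (Indep M)
  noParallelTriple P-down P-no-triple x y z x-indep y-indep z-indep xy-dep xz-dep
    with P-no-triple (f⁻¹ x) (f⁻¹ y) (f⁻¹ z) (non-loop x-indep) (non-loop y-indep) (non-loop z-indep)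
                     (dep xy-dep) (dep xz-dep)
    where
    non-loop : ∀ {w} → Indep M ⁅ w ⁆ → P ⁅ f⁻¹ w ⁆
    non-loop w-indep = P-down (⁅x⁆⊆p (x∈image⁺ f⁻¹ (x∈⁅x⁆ _))) (indep⇒P w-indep)
    dep : ∀ {u v} → ¬ Indep M (u ▸ ⁅ v ⁆) → ¬ P (f⁻¹ u ▸ ⁅ f⁻¹ v ⁆)
    dep uv-dep = uv-dep ∘ P⇒indep ∘ P-down preimage-pair-⊆
  ... | inj₁ x≡y        = inj₁ (f⁻¹-injective x≡y)
  ... | inj₂ (inj₁ x≡z) = inj₂ (inj₁ (f⁻¹-injective x≡z))
  ... | inj₂ (inj₂ y≡z) = inj₂ (inj₂ (f⁻¹-injective y≡z))

-- Direct sums and the partition matroids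

take-∈⁻ : ∀ a {b} (X : Subset (a + b)) {i} → i ∈ take a X → i ↑ˡ b ∈ X
take-∈⁻ (suc a) (_ ∷ X) {zero}  here       = here
take-∈⁻ (suc a) (_ ∷ X) {suc i} (there i∈) = there (take-∈⁻ a X i∈)

take-∈⁺ : ∀ a {b} (X : Subset (a + b)) {i} → i ↑ˡ b ∈ X → i ∈ take a X
take-∈⁺ (suc a) (_ ∷ X) {zero}  here       = here
take-∈⁺ (suc a) (_ ∷ X) {suc i} (there i∈) = there (take-∈⁺ a X i∈)

drop-∈⁻ : ∀ a {b} (X : Subset (a + b)) {j} → j ∈ drop a X → a ↑ʳ j ∈ X
drop-∈⁻ zero    X       j∈ = j∈
drop-∈⁻ (suc a) (_ ∷ X) j∈ = there (drop-∈⁻ a X j∈)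

drop-∈⁺ : ∀ a {b} (X : Subset (a + b)) {j} → a ↑ʳ j ∈ X → j ∈ drop a X
drop-∈⁺ zero    X       j∈         = j∈
drop-∈⁺ (suc a) (_ ∷ X) (there j∈) = drop-∈⁺ a X j∈

∣X∣≡∣take∣+∣drop∣ : ∀ a {b} (X : Subset (a + b)) → ∣ X ∣ ≡ ∣ take a X ∣ + ∣ drop a X ∣
∣X∣≡∣take∣+∣drop∣ zero    X             = refl
∣X∣≡∣take∣+∣drop∣ (suc a) (inside ∷ X)  = cong suc (∣X∣≡∣take∣+∣drop∣ a X)
∣X∣≡∣take∣+∣drop∣ (suc a) (outside ∷ X) = ∣X∣≡∣take∣+∣drop∣ a X

data Summand (a b : ℕ) : Fin (a + b) → Set where
  left  : ∀ i → Summand a b (i ↑ˡ b)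
  right : ∀ j → Summand a b (a ↑ʳ j)

summand : ∀ a {b} x → Summand a b x
summand a x with splitAt a x in eq
... | inj₁ i = subst (Summand a _) (splitAt⁻¹-↑ˡ eq) (left i)
... | inj₂ j = subst (Summand a _) (splitAt⁻¹-↑ʳ eq) (right j)

take-∅ : ∀ a {b} → take a (∅ {a + b}) ≡ ∅
take-∅ zero    = refl
take-∅ (suc a) = cong (outside ∷_) (take-∅ a)

drop-∅ : ∀ a {b} → drop a (∅ {a + b}) ≡ ∅
drop-∅ zero    = refl
drop-∅ (suc a) = drop-∅ a

take-⁅↑ˡ⁆ : ∀ a {b} (i : Fin a) → take a ⁅ i ↑ˡ b ⁆ ≡ ⁅ i ⁆
take-⁅↑ˡ⁆ (suc a) zero    = cong (inside ∷_) (take-∅ a)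
take-⁅↑ˡ⁆ (suc a) (suc i) = cong (outside ∷_) (take-⁅↑ˡ⁆ a i)

drop-⁅↑ˡ⁆ : ∀ a {b} (i : Fin a) → drop a ⁅ i ↑ˡ b ⁆ ≡ ∅
drop-⁅↑ˡ⁆ (suc a) zero    = drop-∅ a
drop-⁅↑ˡ⁆ (suc a) (suc i) = drop-⁅↑ˡ⁆ a i

take-⁅↑ʳ⁆ : ∀ a {b} (j : Fin b) → take a ⁅ a ↑ʳ j ⁆ ≡ ∅
take-⁅↑ʳ⁆ zero    j = refl
take-⁅↑ʳ⁆ (suc a) j = cong (outside ∷_) (take-⁅↑ʳ⁆ a j)

drop-⁅↑ʳ⁆ : ∀ a {b} (j : Fin b) → drop a ⁅ a ↑ʳ j ⁆ ≡ ⁅ j ⁆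
drop-⁅↑ʳ⁆ zero    j = refl
drop-⁅↑ʳ⁆ (suc a) j = drop-⁅↑ʳ⁆ a j

module _ {a b} {Q : IndepPred a} {R : IndepPred b} where

  ⊕-down : DownClosed Q → DownClosed R → DownClosed (Q ⊕ R)
  ⊕-down Q-down R-down X⊆Y (QY , RY) =
    Q-down (take-∈⁺ a _ ∘ X⊆Y ∘ take-∈⁻ a _) QY , R-down (drop-∈⁺ a _ ∘ X⊆Y ∘ drop-∈⁻ a _) RY

  ⊕-⁅↑ˡ⁆ : ∀ {i} → (Q ⊕ R) ⁅ i ↑ˡ b ⁆ → Q ⁅ i ⁆ × R ∅
  ⊕-⁅↑ˡ⁆ {i} (q , r) = subst Q (take-⁅↑ˡ⁆ a i) q , subst R (drop-⁅↑ˡ⁆ a i) r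

  ⊕-⁅↑ʳ⁆ : ∀ {j} → (Q ⊕ R) ⁅ a ↑ʳ j ⁆ → Q ∅ × R ⁅ j ⁆
  ⊕-⁅↑ʳ⁆ {j} (q , r) = subst Q (take-⁅↑ʳ⁆ a j) q , subst R (drop-⁅↑ʳ⁆ a j) r

  private
    ⊕-▸⁅⁆ : ∀ {x y} → Q (take a ⁅ x ⁆ ∪ take a ⁅ y ⁆) → R (drop a ⁅ x ⁆ ∪ drop a ⁅ y ⁆) → (Q ⊕ R) (x ▸ ⁅ y ⁆)
    ⊕-▸⁅⁆ {x} {y} q r =
      subst Q (sym (take-zipWith {m = a} _ ⁅ x ⁆ ⁅ y ⁆)) q , subst R (sym (drop-zipWith {m = a} _ ⁅ x ⁆ ⁅ y ⁆)) r

  ⊕-pairˡ : ∀ {i j} → Q (i ▸ ⁅ j ⁆) → R ∅ → (Q ⊕ R) ((i ↑ˡ b) ▸ ⁅ j ↑ˡ b ⁆)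
  ⊕-pairˡ {i} {j} q r = ⊕-▸⁅⁆
    (subst Q (sym (cong₂ _∪_ (take-⁅↑ˡ⁆ a i) (take-⁅↑ˡ⁆ a j))) q)
    (subst R (sym (trans (cong₂ _∪_ (drop-⁅↑ˡ⁆ a i) (drop-⁅↑ˡ⁆ a j)) (∪-identityʳ ∅))) r)

  ⊕-pairʳ : ∀ {i j} → Q ∅ → R (i ▸ ⁅ j ⁆) → (Q ⊕ R) ((a ↑ʳ i) ▸ ⁅ a ↑ʳ j ⁆)
  ⊕-pairʳ {i} {j} q r = ⊕-▸⁅⁆
    (subst Q (sym (trans (cong₂ _∪_ (take-⁅↑ʳ⁆ a i) (take-⁅↑ʳ⁆ a j)) (∪-identityʳ ∅))) q)
    (subst R (sym (cong₂ _∪_ (drop-⁅↑ʳ⁆ a i) (drop-⁅↑ʳ⁆ a j))) r)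

  ⊕-crossˡʳ : ∀ {i j} → Q ⁅ i ⁆ → R ⁅ j ⁆ → (Q ⊕ R) ((i ↑ˡ b) ▸ ⁅ a ↑ʳ j ⁆)
  ⊕-crossˡʳ {i} {j} q r = ⊕-▸⁅⁆
    (subst Q (sym (trans (cong₂ _∪_ (take-⁅↑ˡ⁆ a i) (take-⁅↑ʳ⁆ a j)) (∪-identityʳ ⁅ i ⁆))) q)
    (subst R (sym (trans (cong₂ _∪_ (drop-⁅↑ˡ⁆ a i) (drop-⁅↑ʳ⁆ a j)) (∪-identityˡ ⁅ j ⁆))) r)

  ⊕-crossʳˡ : ∀ {i j} → R ⁅ i ⁆ → Q ⁅ j ⁆ → (Q ⊕ R) ((a ↑ʳ i) ▸ ⁅ j ↑ˡ b ⁆)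
  ⊕-crossʳˡ {i} {j} r q = ⊕-▸⁅⁆
    (subst Q (sym (trans (cong₂ _∪_ (take-⁅↑ʳ⁆ a i) (take-⁅↑ˡ⁆ a j)) (∪-identityˡ ⁅ j ⁆))) q)
    (subst R (sym (trans (cong₂ _∪_ (drop-⁅↑ʳ⁆ a i) (drop-⁅↑ˡ⁆ a j)) (∪-identityʳ ⁅ i ⁆))) r)

  ⊕-pairDetermined : DownClosed Q → DownClosed R → Decidable Q → PairDetermined Q → PairDetermined R →
                     PairDetermined (Q ⊕ R)
  ⊕-pairDetermined Q-down R-down Q? Q-pairs R-pairs X X-dep with Q? (take a X)
  ... | no ¬Q-take with Q-pairs (take a X) ¬Q-take
  ...   | i , j , i∈ , j∈ , ij-dep =
    i ↑ˡ b , j ↑ˡ b , take-∈⁻ a X i∈ , take-∈⁻ a X j∈ ,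
    ij-dep ∘ Q-down (take-∈⁺ a _ ∘ ∈-map-pair (_↑ˡ b)) ∘ proj₁
  ⊕-pairDetermined Q-down R-down Q? Q-pairs R-pairs X X-dep | yes Q-take
    with R-pairs (drop a X) (λ R-drop → X-dep (Q-take , R-drop))
  ... | i , j , i∈ , j∈ , ij-dep =
    a ↑ʳ i , a ↑ʳ j , drop-∈⁻ a X i∈ , drop-∈⁻ a X j∈ ,
    ij-dep ∘ R-down (drop-∈⁺ a _ ∘ ∈-map-pair (a ↑ʳ_)) ∘ proj₂

  ⊕-noParallelTriple : NoParallelTriple Q → NoParallelTriple R → NoParallelTriple (Q ⊕ R)
  ⊕-noParallelTriple Q-no-triple R-no-triple x y z x-indep y-indep z-indep xy-dep xz-dep
    with summand a x | summand a y | summand a z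
  ... | left i  | right j | _       = ⊥-elim (xy-dep (⊕-crossˡʳ (proj₁ (⊕-⁅↑ˡ⁆ x-indep)) (proj₂ (⊕-⁅↑ʳ⁆ y-indep))))
  ... | right i | left j  | _       = ⊥-elim (xy-dep (⊕-crossʳˡ (proj₂ (⊕-⁅↑ʳ⁆ x-indep)) (proj₁ (⊕-⁅↑ˡ⁆ y-indep))))
  ... | left i  | left j  | right k = ⊥-elim (xz-dep (⊕-crossˡʳ (proj₁ (⊕-⁅↑ˡ⁆ x-indep)) (proj₂ (⊕-⁅↑ʳ⁆ z-indep))))
  ... | right i | right j | left k  = ⊥-elim (xz-dep (⊕-crossʳˡ (proj₂ (⊕-⁅↑ʳ⁆ x-indep)) (proj₁ (⊕-⁅↑ˡ⁆ z-indep))))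
  ... | left i  | left j  | left k
    with Q-no-triple i j k (proj₁ (⊕-⁅↑ˡ⁆ x-indep)) (proj₁ (⊕-⁅↑ˡ⁆ y-indep)) (proj₁ (⊕-⁅↑ˡ⁆ z-indep))
           (λ q → xy-dep (⊕-pairˡ q (proj₂ (⊕-⁅↑ˡ⁆ x-indep)))) (λ q → xz-dep (⊕-pairˡ q (proj₂ (⊕-⁅↑ˡ⁆ x-indep))))
  ...   | inj₁ refl        = inj₁ refl
  ...   | inj₂ (inj₁ refl) = inj₂ (inj₁ refl)
  ...   | inj₂ (inj₂ refl) = inj₂ (inj₂ refl)
  ⊕-noParallelTriple Q-no-triple R-no-triple x y z x-indep y-indep z-indep xy-dep xz-dep
      | right i | right j | right k
    with R-no-triple i j k (proj₂ (⊕-⁅↑ʳ⁆ x-indep)) (proj₂ (⊕-⁅↑ʳ⁆ y-indep)) (proj₂ (⊕-⁅↑ʳ⁆ z-indep))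
           (λ r → xy-dep (⊕-pairʳ (proj₁ (⊕-⁅↑ʳ⁆ x-indep)) r)) (λ r → xz-dep (⊕-pairʳ (proj₁ (⊕-⁅↑ʳ⁆ x-indep)) r))
  ...   | inj₁ refl        = inj₁ refl
  ...   | inj₂ (inj₁ refl) = inj₂ (inj₁ refl)
  ...   | inj₂ (inj₂ refl) = inj₂ (inj₂ refl)

record LoopsAndParallelPairs {m} (P : IndepPred m) : Set where
  field
    decide             : Decidable P
    down               : DownClosed P
    pair-determined    : PairDetermined P
    no-parallel-triple : NoParallelTriple P

⊕-loopsAndParallelPairs : ∀ {a b} {Q : IndepPred a} {R : IndepPred b} →
  LoopsAndParallelPairs Q → LoopsAndParallelPairs R → LoopsAndParallelPairs (Q ⊕ R)
⊕-loopsAndParallelPairs {Q = Q} {R} Q-lap R-lap = record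
  { decide             = Q.decide ⊕? R.decide
  ; down               = ⊕-down Q.down R.down
  ; pair-determined    = ⊕-pairDetermined Q.down R.down Q.decide Q.pair-determined R.pair-determined
  ; no-parallel-triple = ⊕-noParallelTriple {Q = Q} {R} Q.no-parallel-triple R.no-parallel-triple
  }
  where
  module Q = LoopsAndParallelPairs Q-lap
  module R = LoopsAndParallelPairs R-lap

U-down : ∀ r s → DownClosed (U r s)
U-down r s X⊆Y ∣Y∣≤r = ≤-trans (p⊆q⇒∣p∣≤∣q∣ X⊆Y) ∣Y∣≤r

¬U₀-⁅x⁆ : ∀ {s} (x : Fin s) → ¬ U 0 s ⁅ x ⁆
¬U₀-⁅x⁆ x ∣⁅x⁆∣≤0 = 1+n≰n (subst (_≤ 0) (∣⁅x⁆∣≡1 x) ∣⁅x⁆∣≤0)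

U₀-loopsAndParallelPairs : ∀ s → LoopsAndParallelPairs (U 0 s)
U₀-loopsAndParallelPairs s = record
  { decide             = U? 0 s
  ; down               = U-down 0 s
  ; pair-determined    = pair-determined
  ; no-parallel-triple = λ x _ _ x-indep → ⊥-elim (¬U₀-⁅x⁆ x x-indep)
  }
  where
  pair-determined : PairDetermined (U 0 s)
  pair-determined X X-dep with nonempty? X
  ... | yes (i , i∈X) = i , i , i∈X , i∈X , ¬U₀-⁅x⁆ i ∘ U-down 0 s {⁅ i ⁆} (p⊆p∪q ⁅ i ⁆)
  ... | no X-empty    = ⊥-elim (X-dep (≤-reflexive (trans (cong ∣_∣ (Empty-unique X-empty)) (∣⊥∣≡0 s))))

Uₛₛ-loopsAndParallelPairs : ∀ s → LoopsAndParallelPairs (U s s)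
Uₛₛ-loopsAndParallelPairs s = record
  { decide             = U? s s
  ; down               = U-down s s
  ; pair-determined    = λ X X-dep → ⊥-elim (X-dep (∣p∣≤n X))
  ; no-parallel-triple = λ x y _ _ _ _ xy-dep → ⊥-elim (xy-dep (∣p∣≤n (x ▸ ⁅ y ⁆)))
  }

U₁₂-loopsAndParallelPairs : LoopsAndParallelPairs (U 1 2)
U₁₂-loopsAndParallelPairs = record
  { decide             = U? 1 2
  ; down               = U-down 1 2
  ; pair-determined    = pair-determined
  ; no-parallel-triple = no-parallel-triple
  }
  where
  pair-determined : PairDetermined (U 1 2)
  pair-determined (inside  ∷ inside  ∷ []) X-dep = zero , suc zero , here , there here , X-dep
  pair-determined (inside  ∷ outside ∷ []) X-dep = ⊥-elim (X-dep (s≤s z≤n))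
  pair-determined (outside ∷ inside  ∷ []) X-dep = ⊥-elim (X-dep (s≤s z≤n))
  pair-determined (outside ∷ outside ∷ []) X-dep = ⊥-elim (X-dep z≤n)
  no-parallel-triple : NoParallelTriple (U 1 2)
  no-parallel-triple zero       zero       _          _ _ _ _ _ = inj₁ refl
  no-parallel-triple (suc zero) (suc zero) _          _ _ _ _ _ = inj₁ refl
  no-parallel-triple zero       (suc zero) zero       _ _ _ _ _ = inj₂ (inj₁ refl)
  no-parallel-triple zero       (suc zero) (suc zero) _ _ _ _ _ = inj₂ (inj₂ refl)
  no-parallel-triple (suc zero) zero       zero       _ _ _ _ _ = inj₂ (inj₂ refl)
  no-parallel-triple (suc zero) zero       (suc zero) _ _ _ _ _ = inj₂ (inj₁ refl)

U12pow-loopsAndParallelPairs : ∀ l → LoopsAndParallelPairs (U12pow l)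
U12pow-loopsAndParallelPairs zero = record
  { decide             = λ _ → yes _
  ; down               = λ _ _ → _
  ; pair-determined    = λ _ X-dep → ⊥-elim (X-dep _)
  ; no-parallel-triple = λ ()
  }
U12pow-loopsAndParallelPairs (suc l) =
  ⊕-loopsAndParallelPairs U₁₂-loopsAndParallelPairs (U12pow-loopsAndParallelPairs l)

U₀⊕U₁-rankAtMostOne : ∀ a b → RankAtMostOne (U 0 a ⊕ U 1 b)
U₀⊕U₁-rankAtMostOne a b X {x} {y} x≢y x∈X y∈X (∣take∣≤0 , ∣drop∣≤1) = 1+n≰n (begin
  2                                ≡⟨ cong suc (sym (∣⁅x⁆∣≡1 y)) ⟩
  suc ∣ ⁅ y ⁆ ∣                     ≡⟨ sym (∣x▸p∣≡1+∣p∣ (x≢y⇒x∉⁅y⁆ x≢y)) ⟩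
  ∣ x ▸ ⁅ y ⁆ ∣                     ≤⟨ p⊆q⇒∣p∣≤∣q∣ (x▸p⊆q x∈X (⁅x⁆⊆p y∈X)) ⟩
  ∣ X ∣                            ≡⟨ ∣X∣≡∣take∣+∣drop∣ a X ⟩
  ∣ take a X ∣ + ∣ drop a X ∣       ≤⟨ +-mono-≤ ∣take∣≤0 ∣drop∣≤1 ⟩
  1                                ∎)
  where open ≤-Reasoning

Uₖₖ₊₁⊕Uₛₛ-dependentMeets : ∀ k s → DependentMeets (U k (suc k) ⊕ U s s)
Uₖₖ₊₁⊕Uₛₛ-dependentMeets k s {X} {Y} {Z} X-dep Y-dep X∩Y⊆Z (∣take∣≤k , _) = 1+n≰n (begin
  suc k                 ≡⟨ sym (∣⊤∣≡n (suc k)) ⟩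
  ∣ ⊤ {suc k} ∣         ≤⟨ p⊆q⇒∣p∣≤∣q∣ {p = ⊤} ⊤⊆take ⟩
  ∣ take (suc k) Z ∣    ≤⟨ ∣take∣≤k ⟩
  k                     ∎)
  where
  open ≤-Reasoning
  dependent⇒∈take : ∀ {W} → ¬ (U k (suc k) ⊕ U s s) W → ∀ i → i ∈ take (suc k) W
  dependent⇒∈take {W} W-dep i = subst (i ∈_) (sym (∣p∣≡n⇒p≡⊤ ∣take∣≡1+k)) ∈⊤
    where
    ∣take∣≡1+k : ∣ take (suc k) W ∣ ≡ suc k
    ∣take∣≡1+k = ≤-antisym (∣p∣≤n (take (suc k) W)) (≰⇒> λ ∣take∣≤k → W-dep (∣take∣≤k , ∣p∣≤n (drop (suc k) W)))
  ⊤⊆take : ⊤ ⊆ take (suc k) Z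
  ⊤⊆take {i} _ = take-∈⁺ (suc k) Z (X∩Y⊆Z (x∈p∩q⁺
    (take-∈⁻ (suc k) X (dependent⇒∈take {X} X-dep i) , take-∈⁻ (suc k) Y (dependent⇒∈take {Y} Y-dep i))))

InN-dual : ∀ {n} (M M* : Matroid n) → IsDual M M* → InN M → InN M*
InN-dual M M* M*-dual (¬U₁₁⊕U₁₃ , ¬U₀₁⊕U₂₃) =
  ¬U₀₁⊕U₂₃ ∘ loopTriangle⇒hasMinor ∘ coloopParallelTriple*⇒loopTriangle ∘ hasMinor⇒coloopParallelTriple ,
  ¬U₁₁⊕U₁₃ ∘ coloopParallelTriple⇒hasMinor ∘ loopTriangle*⇒coloopParallelTriple ∘ hasMinor⇒loopTriangle
  where open DualMinors M M* M*-dual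

sparsePaving⇒InN : ∀ {n} (M : Matroid n) → SparsePaving M → InN M
sparsePaving⇒InN M (M-paving , duals-paving) =
  paving⇒¬loopTriangle dual (duals-paving dual dual-isDual) ∘ coloopParallelTriple*⇒loopTriangle
    ∘ hasMinor⇒coloopParallelTriple ,
  paving⇒¬loopTriangle M M-paving ∘ hasMinor⇒loopTriangle
  where
  open MatroidProperties M using (dual; dual-isDual)
  open DualMinors dual M (Duality.dual-involutive M dual dual-isDual)

-- The size constraints of the partition matroids below only exclude truncated subtraction; none is needed.

U₀⊕U12pow⊕Uₛₛ-InN : ∀ n k l → k ≤ n → l ≤ k → l ≤ n ∸ k → (M : Matroid n) →
                    IsoTo M (U 0 (n ∸ k ∸ l) ⊕ U12pow l ⊕ U (k ∸ l) (k ∸ l)) → InN M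
U₀⊕U12pow⊕Uₛₛ-InN n k l _ _ _ M iso = loopsAndParallelPairs⇒InN M
  (Relabel.pairDetermined M iso down pair-determined) (Relabel.noParallelTriple M iso down no-parallel-triple)
  where
  open LoopsAndParallelPairs (⊕-loopsAndParallelPairs (U₀-loopsAndParallelPairs (n ∸ k ∸ l))
         (⊕-loopsAndParallelPairs (U12pow-loopsAndParallelPairs l) (Uₛₛ-loopsAndParallelPairs (k ∸ l))))

U₀⊕U₁-InN : ∀ n l → 3 ≤ l → l < n → (M : Matroid n) → IsoTo M (U 0 (n ∸ l) ⊕ U 1 l) → InN M
U₀⊕U₁-InN n l _ _ M iso = rank≤1⇒InN M (Relabel.rankAtMostOne M iso (U₀⊕U₁-rankAtMostOne (n ∸ l) l))

Uₗ₋₁ₗ⊕Uₛₛ-InN : ∀ n l → 3 ≤ l → l < n → (M : Matroid n) → IsoTo M (U (l ∸ 1) l ⊕ U (n ∸ l) (n ∸ l)) → InN M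
Uₗ₋₁ₗ⊕Uₛₛ-InN n (suc k) _ _ M iso =
  dependentMeets⇒InN M (Relabel.dependentMeets M iso (Uₖₖ₊₁⊕Uₛₛ-dependentMeets k (n ∸ suc k)))

lemma4p4 :
    (∀ {n} (M M* : Matroid n) → IsDual M M* → InN M → InN M*)
    × (∀ {n} (M : Matroid n) → SparsePaving M → InN M)
    × (∀ n k l → k ≤ n → l ≤ k → l ≤ n ∸ k → (M : Matroid n) →
         IsoTo M (U 0 (n ∸ k ∸ l) ⊕ U12pow l ⊕ U (k ∸ l) (k ∸ l)) → InN M)
    × (∀ n l → 3 ≤ l → l < n → (M : Matroid n) →
         IsoTo M (U 0 (n ∸ l) ⊕ U 1 l) → InN M)
    × (∀ n l → 3 ≤ l → l < n → (M : Matroid n) →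
         IsoTo M (U (l ∸ 1) l ⊕ U (n ∸ l) (n ∸ l)) → InN M)
lemma4p4 = InN-dual , sparsePaving⇒InN , U₀⊕U12pow⊕Uₛₛ-InN , U₀⊕U₁-InN , Uₗ₋₁ₗ⊕Uₛₛ-InN
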